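{- Let $n,r\ge 1$ and $m\ge 1$, and let $X:\mathfrak{S}_{n,r}\to\mathbb{R}$ be a colored permutation statistic of degree at most $m$. Then for every integer $k\ge 1$, the $k$th moment $\mathbb{E}_{\boldsymbol{\lambda}}[X^k]$ takes the same value on all conjugacy classes $C_{\boldsymbol{\lambda}}$ of $\mathfrak{S}_{n,r}$ that have no cycles of length $1,2,\ldots,mk$.
   Context: The colored permutation group $\mathfrak{S}_{n,r}=\mathbb{Z}_r\wr\mathfrak{S}_n$ consists of pairs $(\omega,\tau)$ with $\omega\in\mathfrak{S}_n$ and $\tau:[n]\to\mathbb{Z}_r$ (a coloring); it acts on $[n]^r=\{i^c: i\in[n],c\in\mathbb{Z}_r\}$ by $(\omega,\tau)(i^c)=\omega(i)^{\tau(\omega(i))+c}$, and the group law is composition of these bijections. A cycle of $(\omega,\tau)$ is a cycle of $\omega$; its length is its length as a cycle of $\omega$, and its color is $\sum_j \tau(j)\in\mathbb{Z}_r$ over the elements $j$ of the cycle. The cycle type is the multiset of (length, color) pairs of the cycles; it is recorded by an $r$-partition $\boldsymbol{\lambda}=(\lambda^0,\ldots,\lambda^{r-1})$ where $m_i(\lambda^c)$ is the number of cycles of length $i$ and color $c$. The conjugacy classes of $\mathfrak{S}_{n,r}$ are exactly the sets $C_{\boldsymbol{\lambda}}$ of elements of cycle type $\boldsymbol{\lambda}$. $\mathbb{E}_{\boldsymbol{\lambda}}$ denotes expectation under the uniform distribution on $C_{\boldsymbol{\lambda}}$. A partial colored permutation of size $m$ is a pair $(K,\kappa)$ where $K=\{(i_h,j_h)\}_{h=1}^m$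 is a set of $m$ ordered pairs of elements of $[n]$ with the $i_h$ distinct and the $j_h$ distinct, and $\kappa:\{j_1,\ldots,j_m\}\to\mathbb{Z}_r$. A colored permutation $(\omega,\tau)$ satisfies $(K,\kappa)$ if $\omega(i_h)=j_h$ and $\tau(j_h)=\kappa(j_h)$ for all $h$; $I_{(K,\kappa)}$ is the indicator function of this event on $\mathfrak{S}_{n,r}$. A statistic $X:\mathfrak{S}_{n,r}\to\mathbb{R}$ has degree at most $m$ if it lies in the real span of $\{I_{(K,\kappa)}\}$ over partial colored permutations of size at most $m$.
   Formalization: The statistic X takes rational values, and the coefficients expressing it in the span of the indicators $I_{(K,\kappa)}$ are rational rather than real. -}

module Defs where

open import Data.Nat using (ℕ; zero; suc; _≤_; NonZero)
open import Data.Nat.DivMod using (_mod_)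
open import Data.Fin using (Fin; toℕ)
open import Data.Vec using (Vec; lookup)
open import Data.List using (List; []; _∷_; map; length)
open import Data.List.Relation.Unary.All using (All)
open import Data.List.Relation.Unary.Unique.Propositional using (Unique)
open import Data.List.Membership.Propositional using (_∈_)
open import Data.Product using (_×_; _,_; proj₁; proj₂; ∃)
open import Data.Rational using (ℚ; 0ℚ; 1ℚ; _+_; _*_)
open import Data.Integer using (ℤ)
open import Relation.Binary.PropositionalEquality using (_≡_; _≢_)
open import Relation.Nullary using (Dec; yes; no; does)
open import Function.Bundles using (_⇔_)
open import Function.Definitions using (Injective)
import Data.Nat as ℕ
import Data.Rational as ℚ

-- ℤ_r represented by Fin r, with addition mod r
_⊕_ : {r : ℕ} .{{_ : NonZero r}} → Fin r → Fin r → Fin r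
_⊕_ {r} a b = (toℕ a ℕ.+ toℕ b) mod r

-- Candidate elements (ω, τ) of 𝔖_{n,r}: ω as the vector of values ω(0..n-1),
-- τ as the vector of colors τ(0..n-1).
Elem : ℕ → ℕ → Set
Elem n r = Vec (Fin n) n × Vec (Fin r) n

-- ω is a permutation of [n] (an injective self-map of a finite set)
IsPerm : {n : ℕ} → Vec (Fin n) n → Set
IsPerm w = Injective _≡_ _≡_ (lookup w)

IsElem : {n r : ℕ} → Elem n r → Set
IsElem g = IsPerm (proj₁ g)

-- action on [n]^r : (ω,τ)(i^c) = ω(i)^{τ(ω(i)) + c}
act : {n r : ℕ} .{{_ : NonZero r}} → Elem n r → Fin n × Fin r → Fin n × Fin r
act (w , t) (i , c) = lookup w i , (lookup t (lookup w i) ⊕ c)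

-- h is conjugate to g : h = x g x⁻¹ for some group element x, i.e. h ∘ x = x ∘ g
ConjClass : {n r : ℕ} .{{_ : NonZero r}} → Elem n r → Elem n r → Set
ConjClass {n} {r} g h = IsElem h × ∃ λ (x : Elem n r) → IsElem x ×
  (∀ (i : Fin n) (c : Fin r) → act h (act x (i , c)) ≡ act x (act g (i , c)))

iter : {A : Set} → (A → A) → ℕ → A → A
iter f zero a = a
iter f (suc p) a = f (iter f p a)

NoShortCycles : {n r : ℕ} → ℕ → Elem n r → Set
NoShortCycles {n} L g =
  ∀ (i : Fin n) (p : ℕ) → 1 ≤ p → p ≤ L → iter (lookup (proj₁ g)) p i ≢ i

-- Partial colored permutation (K, κ): entries (i_h, j_h, κ(j_h)),
-- with the i_h distinct and the j_h distinct; its size is the number of entries.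
record PCP (n r : ℕ) : Set where
  field
    entries : List (Fin n × Fin n × Fin r)
    is-distinct : Unique (map proj₁ entries)
    js-distinct : Unique (map (λ e → proj₁ (proj₂ e)) entries)

size : {n r : ℕ} → PCP n r → ℕ
size K = length (PCP.entries K)

open import Data.Fin using (_≟_)
open import Data.Bool using (Bool; true; false; _∧_)

satisfiesEntry : {n r : ℕ} → Elem n r → Fin n × Fin n × Fin r → Bool
satisfiesEntry (w , t) (i , j , c) = does (lookup w i ≟ j) ∧ does (lookup t j ≟ c)

allB : {A : Set} → (A → Bool) → List A → Bool
allB p [] = true
allB p (x ∷ xs) = p x ∧ allB p xs

indicator : {n r : ℕ} → PCP n r → Elem n r → ℚ
indicator K g with allB (satisfiesEntry g) (PCP.entries K)
... | true = 1ℚ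
... | false = 0ℚ

sumℚ : List ℚ → ℚ
sumℚ [] = 0ℚ
sumℚ (x ∷ xs) = x + sumℚ xs

DegreeAtMost : {n r : ℕ} → ℕ → (Elem n r → ℚ) → Set
DegreeAtMost {n} {r} m X = ∃ λ (comb : List (ℚ × PCP n r)) →
  All (λ aK → size (proj₂ aK) ≤ m) comb ×
  (∀ g → IsElem g → X g ≡ sumℚ (map (λ aK → proj₁ aK * indicator (proj₂ aK) g) comb))

Enumerates : {A : Set} → List A → (A → Set) → Set
Enumerates {A} L P = Unique L × (∀ (a : A) → (a ∈ L) ⇔ P a)

-- mean of a list (uniform expectation); 0 for the empty list
mean : List ℚ → ℚ
mean [] = 0ℚ
mean (x ∷ xs) = sumℚ (x ∷ xs) * (ℚ._/_ (ℤ.1ℤ) (suc (length xs)))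
  where import Data.Integer as ℤ

powℚ : ℚ → ℕ → ℚ
powℚ x zero = 1ℚ
powℚ x (suc k) = x * powℚ x k

{-# OPTIONS --safe #-}
module Submission where

-- Expanding X^k into products of indicators writes the k-th moment on a class C as a linear
-- combination of the proportions of C satisfying lists E of at most mk entries i ↦ j (with the
-- colour of j prescribed). So it suffices that each such proportion is the same for all classes
-- without cycles of length ≤ length E. This goes by induction on the length of E and the number
-- of vertices it mentions. A duplicated entry can be dropped. If some entry a ↦ b has a fresh
-- target (b ≠ a and b is not mentioned by the other entries E′), summing over all choices of
-- (b , c) for that entry gives the count for E′; conjugating by a transposition of targets and by
-- a colour change at b shows that all fresh choices have the same count, while every other choice
-- mentions fewer vertices and is covered by induction, so the common count of the fresh choices is
-- determined. If no entry has a fresh target, the sources of E are closed under any permutation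
-- satisfying E, which therefore has a cycle of length ≤ length E: no element of C satisfies E.

open import Defs

module Sums where

  open import Data.Bool using (Bool; true; false; if_then_else_)
  open import Data.List using (List; []; _∷_; map; length; filter)
  open import Data.List.Membership.Propositional using (_∈_)
  open import Data.List.Membership.Propositional.Properties.WithK using (unique∧set⇒bag)
  open import Data.List.Properties using (map-∘)
  open import Data.List.Relation.Binary.BagAndSetEquality using (∼bag⇒↭)
  open import Data.List.Relation.Binary.Permutation.Propositional.Properties using (map⁺)
  open import Data.List.Relation.Unary.All as All using ([]; _∷_)
  open import Data.List.Relation.Unary.AllPairs using ([]; _∷_)
  open import Data.List.Relation.Unary.Any using (here; there)
  open import Data.List.Relation.Unary.Unique.Propositional using (Unique)
  open import Data.Nat using (ℕ; _+_; _*_; _≤_; _<_; z≤n; s≤s; >-nonZero)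
  open import Data.Nat.ListAction using (sum)
  open import Data.Nat.ListAction.Properties using (sum-↭)
  open import Data.Nat.Properties
  open import Algebra.Properties.CommutativeSemigroup +-commutativeSemigroup
    using () renaming (interchange to +-interchange)
  open import Function.Bundles using (_⇔_)
  open import Level using (0ℓ)
  open import Relation.Binary.Definitions using (DecidableEquality)
  open import Relation.Binary.PropositionalEquality
  open import Relation.Nullary using (yes; no; does; ¬_; contradiction)
  open import Relation.Unary using (Pred; Decidable)

  private variable A B : Set

  sumℕ : (A → ℕ) → List A → ℕ
  sumℕ f xs = sum (map f xs)

  sumℕ-cong : {f g : A → ℕ} (xs : List A) → (∀ x → x ∈ xs → f x ≡ g x) → sumℕ f xs ≡ sumℕ g xs
  sumℕ-cong []       f≗g = refl
  sumℕ-cong (x ∷ xs) f≗g = cong₂ _+_ (f≗g x (here refl)) (sumℕ-cong xs (λ y y∈xs → f≗g y (there y∈xs)))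

  sumℕ-const : (k : ℕ) (xs : List A) → sumℕ (λ _ → k) xs ≡ length xs * k
  sumℕ-const k []       = refl
  sumℕ-const k (x ∷ xs) = cong (k +_) (sumℕ-const k xs)

  sumℕ-zero : (xs : List A) → sumℕ (λ _ → 0) xs ≡ 0
  sumℕ-zero xs = trans (sumℕ-const 0 xs) (*-zeroʳ (length xs))

  sumℕ-+ : (f g : A → ℕ) (xs : List A) → sumℕ (λ x → f x + g x) xs ≡ sumℕ f xs + sumℕ g xs
  sumℕ-+ f g []       = refl
  sumℕ-+ f g (x ∷ xs) = trans (cong (f x + g x +_) (sumℕ-+ f g xs)) (+-interchange (f x) (g x) _ _)

  sumℕ-*ʳ : (k : ℕ) (f : A → ℕ) (xs : List A) → sumℕ (λ x → f x * k) xs ≡ sumℕ f xs * k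
  sumℕ-*ʳ k f []       = refl
  sumℕ-*ʳ k f (x ∷ xs) = trans (cong (f x * k +_) (sumℕ-*ʳ k f xs)) (sym (*-distribʳ-+ k (f x) _))

  sumℕ-mono-≤ : {f g : A → ℕ} (xs : List A) → (∀ x → f x ≤ g x) → sumℕ f xs ≤ sumℕ g xs
  sumℕ-mono-≤ []       f≤g = z≤n
  sumℕ-mono-≤ (x ∷ xs) f≤g = +-mono-≤ (f≤g x) (sumℕ-mono-≤ xs f≤g)

  sumℕ-mono-< : {f g : A → ℕ} {x₀ : A} (xs : List A) → (∀ x → f x ≤ g x) →
    x₀ ∈ xs → f x₀ < g x₀ → sumℕ f xs < sumℕ g xs
  sumℕ-mono-< (x ∷ xs) f≤g (here refl)   lt = +-mono-<-≤ lt (sumℕ-mono-≤ xs f≤g)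
  sumℕ-mono-< (x ∷ xs) f≤g (there x₀∈xs) lt = +-mono-≤-< (f≤g x) (sumℕ-mono-< xs f≤g x₀∈xs lt)

  sumℕ-map : (f : B → ℕ) (φ : A → B) (xs : List A) → sumℕ f (map φ xs) ≡ sumℕ (λ x → f (φ x)) xs
  sumℕ-map f φ xs = cong sum (sym (map-∘ xs))

  sumℕ-comm : (f : A → B → ℕ) (xs : List A) (ys : List B) →
    sumℕ (λ x → sumℕ (f x) ys) xs ≡ sumℕ (λ y → sumℕ (λ x → f x y) xs) ys
  sumℕ-comm f []       ys = sym (sumℕ-zero ys)
  sumℕ-comm f (x ∷ xs) ys = trans (cong (sumℕ (f x) ys +_) (sumℕ-comm f xs ys)) (sym (sumℕ-+ (f x) _ ys))

  sumℕ-set-equal : (f : A → ℕ) {xs ys : List A} → Unique xs → Unique ys →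
    (∀ {x} → x ∈ xs ⇔ x ∈ ys) → sumℕ f xs ≡ sumℕ f ys
  sumℕ-set-equal f xs! ys! xs≈ys = sum-↭ (map⁺ f (∼bag⇒↭ (unique∧set⇒bag xs! ys! xs≈ys)))

  sumℕ-if : (b : Bool) (F : A → ℕ) (xs : List A) →
    sumℕ (λ x → if b then F x else 0) xs ≡ (if b then sumℕ F xs else 0)
  sumℕ-if true  F xs = refl
  sumℕ-if false F xs = sumℕ-zero xs

  module _ (_≟_ : DecidableEquality A) where

    sumℕ-δ : (F : A → ℕ) {v : A} (xs : List A) → Unique xs → v ∈ xs →
      sumℕ (λ x → if does (v ≟ x) then F x else 0) xs ≡ F v
    sumℕ-δ F {v} (x ∷ xs) (x∉xs ∷ xs!) (here refl) with v ≟ v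
    ... | no v≢v = contradiction refl v≢v
    ... | yes _  = trans (cong (F v +_) (trans (sumℕ-cong xs off-v) (sumℕ-zero xs))) (+-identityʳ (F v))
      where
        off-v : ∀ y → y ∈ xs → (if does (v ≟ y) then F y else 0) ≡ 0
        off-v y y∈xs with v ≟ y
        ... | yes refl = contradiction refl (All.lookup x∉xs y∈xs)
        ... | no _     = refl
    sumℕ-δ F {v} (x ∷ xs) (x∉xs ∷ xs!) (there v∈xs) with v ≟ x
    ... | yes refl = contradiction refl (All.lookup x∉xs v∈xs)
    ... | no _     = sumℕ-δ F xs xs! v∈xs

  module _ {P : Pred A 0ℓ} (P? : Decidable P) where

    filter-nonempty : {x : A} (xs : List A) → x ∈ xs → P x → 1 ≤ length (filter P? xs)
    filter-nonempty (y ∷ xs) (here refl) Py with P? y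
    ... | yes _  = s≤s z≤n
    ... | no ¬Py = contradiction Py ¬Py
    filter-nonempty (y ∷ xs) (there x∈xs) Px with does (P? y)
    ... | true  = ≤-trans (filter-nonempty xs x∈xs Px) (n≤1+n _)
    ... | false = filter-nonempty xs x∈xs Px

    sumℕ-offset : {f g : A → ℕ} {c d : ℕ} (xs : List A) →
      (∀ x → P x → f x ≡ c) → (∀ x → P x → g x ≡ d) → (∀ x → ¬ P x → f x ≡ g x) →
      sumℕ f xs + length (filter P? xs) * d ≡ sumℕ g xs + length (filter P? xs) * c
    sumℕ-offset []       _  _  _  = refl
    sumℕ-offset {f} {g} {c} {d} (x ∷ xs) f≡c g≡d f≡g with P? x | sumℕ-offset xs f≡c g≡d f≡g
    ... | yes Px | ih rewrite f≡c x Px | g≡d x Px = begin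
      (c + F) + (d + k * d) ≡⟨ +-interchange c F d (k * d) ⟩
      (c + d) + (F + k * d) ≡⟨ cong ((c + d) +_) ih ⟩
      (c + d) + (G + k * c) ≡⟨ cong (_+ (G + k * c)) (+-comm c d) ⟩
      (d + c) + (G + k * c) ≡⟨ +-interchange d c G (k * c) ⟩
      (d + G) + (c + k * c) ∎
      where
        open ≡-Reasoning
        F G k : ℕ
        F = sumℕ f xs
        G = sumℕ g xs
        k = length (filter P? xs)
    ... | no ¬Px | ih rewrite f≡g x ¬Px =
      trans (+-assoc (g x) _ _) (trans (cong (g x +_) ih) (sym (+-assoc (g x) _ _)))

    equal-sums⇒equal-constants : {f g : A → ℕ} {c d : ℕ} {x₀ : A} (xs : List A) →
      (∀ x → P x → f x ≡ c) → (∀ x → P x → g x ≡ d) → (∀ x → ¬ P x → f x ≡ g x) →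
      sumℕ f xs ≡ sumℕ g xs → x₀ ∈ xs → P x₀ → c ≡ d
    equal-sums⇒equal-constants {c = c} {d} xs f≡c g≡d f≡g Σf≡Σg x₀∈xs Px₀ =
      *-cancelˡ-≡ c d (length (filter P? xs)) {{>-nonZero (filter-nonempty xs x₀∈xs Px₀)}}
        (sym (+-cancelˡ-≡ _ _ _ (trans (sumℕ-offset xs f≡c g≡d f≡g) (cong (_+ _) (sym Σf≡Σg)))))
module Colours where

  open import Data.Fin using (Fin; toℕ)
  open import Data.Fin.Properties using (toℕ-injective; toℕ-fromℕ<; toℕ<n)
  open import Data.Nat using (ℕ; _+_; _∸_; _%_; NonZero; >-nonZero⁻¹)
  open import Data.Nat.DivMod using (_mod_; %-distribˡ-+; m%n%n≡m%n; m<n⇒m%n≡m; n%n≡0)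
  open import Data.Nat.Properties using (+-comm; +-assoc; m+[n∸m]≡n; <⇒≤)
  open import Relation.Binary.PropositionalEquality

  module _ {r : ℕ} .{{_ : NonZero r}} where

    0# : Fin r
    0# = 0 mod r

    infix 30 ⊖_
    ⊖_ : Fin r → Fin r
    ⊖ d = (r ∸ toℕ d) mod r

    private
      toℕ-⊕ : (a b : Fin r) → toℕ (a ⊕ b) ≡ (toℕ a + toℕ b) % r
      toℕ-⊕ a b = toℕ-fromℕ< _

      %-absorbˡ : ∀ x y → (x % r + y) % r ≡ (x + y) % r
      %-absorbˡ x y = begin
        (x % r + y) % r             ≡⟨ %-distribˡ-+ (x % r) y r ⟩
        (x % r % r + y % r) % r     ≡⟨ cong (λ z → (z + y % r) % r) (m%n%n≡m%n x r) ⟩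
        (x % r + y % r) % r         ≡⟨ %-distribˡ-+ x y r ⟨
        (x + y) % r                 ∎
        where open ≡-Reasoning

      %-absorbʳ : ∀ x y → (x + y % r) % r ≡ (x + y) % r
      %-absorbʳ x y = begin
        (x + y % r) % r ≡⟨ cong (_% r) (+-comm x (y % r)) ⟩
        (y % r + x) % r ≡⟨ %-absorbˡ y x ⟩
        (y + x) % r     ≡⟨ cong (_% r) (+-comm y x) ⟩
        (x + y) % r     ∎
        where open ≡-Reasoning

    ⊕-assoc : (a b c : Fin r) → (a ⊕ b) ⊕ c ≡ a ⊕ (b ⊕ c)
    ⊕-assoc a b c = toℕ-injective (begin
      toℕ ((a ⊕ b) ⊕ c)               ≡⟨ toℕ-⊕ (a ⊕ b) c ⟩
      (toℕ (a ⊕ b) + C) % r           ≡⟨ cong (λ z → (z + C) % r) (toℕ-⊕ a b) ⟩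
      ((A + B) % r + C) % r           ≡⟨ %-absorbˡ (A + B) C ⟩
      (A + B + C) % r                 ≡⟨ cong (_% r) (+-assoc A B C) ⟩
      (A + (B + C)) % r               ≡⟨ %-absorbʳ A (B + C) ⟨
      (A + (B + C) % r) % r           ≡⟨ cong (λ z → (A + z) % r) (toℕ-⊕ b c) ⟨
      (A + toℕ (b ⊕ c)) % r           ≡⟨ toℕ-⊕ a (b ⊕ c) ⟨
      toℕ (a ⊕ (b ⊕ c))               ∎)
      where
        open ≡-Reasoning
        A = toℕ a
        B = toℕ b
        C = toℕ c

    ⊕-comm : (a b : Fin r) → a ⊕ b ≡ b ⊕ a
    ⊕-comm a b = toℕ-injective (trans (toℕ-⊕ a b)
      (trans (cong (_% r) (+-comm (toℕ a) (toℕ b))) (sym (toℕ-⊕ b a))))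

    ⊕-identityˡ : (a : Fin r) → 0# ⊕ a ≡ a
    ⊕-identityˡ a = toℕ-injective (begin
      toℕ (0# ⊕ a)             ≡⟨ toℕ-⊕ 0# a ⟩
      (toℕ 0# + toℕ a) % r     ≡⟨ cong (λ z → (z + toℕ a) % r) (toℕ-fromℕ< _) ⟩
      (0 % r + toℕ a) % r      ≡⟨ %-absorbˡ 0 (toℕ a) ⟩
      toℕ a % r                ≡⟨ m<n⇒m%n≡m (toℕ<n a) ⟩
      toℕ a                    ∎)
      where open ≡-Reasoning

    ⊕-inverseʳ : (a : Fin r) → a ⊕ (⊖ a) ≡ 0#
    ⊕-inverseʳ a = toℕ-injective (begin
      toℕ (a ⊕ (⊖ a))                  ≡⟨ toℕ-⊕ a (⊖ a) ⟩
      (toℕ a + toℕ (⊖ a)) % r          ≡⟨ cong (λ z → (toℕ a + z) % r) (toℕ-fromℕ< _) ⟩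
      (toℕ a + (r ∸ toℕ a) % r) % r    ≡⟨ %-absorbʳ (toℕ a) (r ∸ toℕ a) ⟩
      (toℕ a + (r ∸ toℕ a)) % r        ≡⟨ cong (_% r) (m+[n∸m]≡n (<⇒≤ (toℕ<n a))) ⟩
      r % r                            ≡⟨ n%n≡0 r ⟩
      0                                ≡⟨ m<n⇒m%n≡m (>-nonZero⁻¹ r) ⟨
      0 % r                            ≡⟨ toℕ-fromℕ< _ ⟨
      toℕ 0#                           ∎)
      where open ≡-Reasoning

    ⊕-identityʳ : (a : Fin r) → a ⊕ 0# ≡ a
    ⊕-identityʳ a = trans (⊕-comm a 0#) (⊕-identityˡ a)

    ⊕-inverseˡ : (a : Fin r) → (⊖ a) ⊕ a ≡ 0#
    ⊕-inverseˡ a = trans (⊕-comm (⊖ a) a) (⊕-inverseʳ a)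

    ⊕⊖-cancel : (x d : Fin r) → (x ⊕ d) ⊕ (⊖ d) ≡ x
    ⊕⊖-cancel x d = trans (⊕-assoc x d (⊖ d)) (trans (cong (x ⊕_) (⊕-inverseʳ d)) (⊕-identityʳ x))

    ⊖⊕-cancel : (x d : Fin r) → (x ⊕ (⊖ d)) ⊕ d ≡ x
    ⊖⊕-cancel x d = trans (⊕-assoc x (⊖ d) d) (trans (cong (x ⊕_) (⊕-inverseˡ d)) (⊕-identityʳ x))

    ⊕-cancelʳ : (a b d : Fin r) → a ⊕ d ≡ b ⊕ d → a ≡ b
    ⊕-cancelʳ a b d eq = trans (sym (⊕⊖-cancel a d)) (trans (cong (_⊕ (⊖ d)) eq) (⊕⊖-cancel b d))

    ⊖-involutive : (d : Fin r) → ⊖ (⊖ d) ≡ d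
    ⊖-involutive d = begin
      ⊖ (⊖ d)                     ≡⟨ ⊖⊕-cancel (⊖ (⊖ d)) d ⟨
      (⊖ (⊖ d) ⊕ (⊖ d)) ⊕ d       ≡⟨ cong (_⊕ d) (⊕-inverseˡ (⊖ d)) ⟩
      0# ⊕ d                      ≡⟨ ⊕-identityˡ d ⟩
      d                           ∎
      where open ≡-Reasoning

module ColouredPermutations where

  open Colours
  open import Data.Bool using (_∧_; if_then_else_)
  open import Data.Fin using (Fin; _≟_; punchOut)
  open import Data.Fin.Permutation using (Permutation; _⟨$⟩ʳ_; _⟨$⟩ˡ_; inverseˡ; inverseʳ; flip; transpose)
  open import Data.Fin.Properties using (any?; injective⇒≤; punchOut-injective)
  open import Data.Nat using (ℕ; zero; suc; NonZero)
  open import Data.Nat.Properties using (1+n≰n)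
  open import Data.Product using (_×_; _,_; proj₁; proj₂; ∃)
  open import Data.Vec using (lookup; tabulate)
  open import Data.Vec.Properties using (lookup∘tabulate; tabulate∘lookup; tabulate-cong)
  open import Function.Definitions using (Injective)
  open import Relation.Binary.Definitions using (DecidableEquality)
  open import Relation.Binary.PropositionalEquality
  open import Relation.Nullary using (yes; no; does; contradiction)
  open import Relation.Nullary.Decidable using (dec-true; dec-false)

  does-≟-injective : {A B : Set} (_≟A_ : DecidableEquality A) (_≟B_ : DecidableEquality B) {f : A → B} →
    Injective _≡_ _≡_ f → (x y : A) → does (f x ≟B f y) ≡ does (x ≟A y)
  does-≟-injective _≟A_ _≟B_ {f} f-inj x y with x ≟A y
  ... | yes refl = dec-true (f x ≟B f x) refl
  ... | no x≢y   = dec-false (f x ≟B f y) (λ fx≡fy → x≢y (f-inj fx≡fy))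

  Fin-injective⇒surjective : {n : ℕ} {f : Fin n → Fin n} → Injective _≡_ _≡_ f → ∀ j → ∃ λ i → f i ≡ j
  Fin-injective⇒surjective {zero}  _ ()
  Fin-injective⇒surjective {suc n} {f} f-inj j with any? (λ i → f i ≟ j)
  ... | yes hit = hit
  ... | no miss = contradiction (injective⇒≤ f′-inj) 1+n≰n
    where
      f≢j : ∀ i → j ≢ f i
      f≢j i j≡fi = miss (i , sym j≡fi)
      f′ : Fin (suc n) → Fin n
      f′ i = punchOut (f≢j i)
      f′-inj : Injective _≡_ _≡_ f′
      f′-inj eq = f-inj (punchOut-injective (f≢j _) (f≢j _) eq)

  iter-intertwine : {A B : Set} (f : A → A) (g : B → B) (φ : B → A) → (∀ y → f (φ y) ≡ φ (g y)) →
    ∀ p y → iter f p (φ y) ≡ φ (iter g p y)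
  iter-intertwine f g φ fφ≡φg zero    y = refl
  iter-intertwine f g φ fφ≡φg (suc p) y =
    trans (cong f (iter-intertwine f g φ fφ≡φg p y)) (fφ≡φg (iter g p y))

  tabulate-isPerm : {n : ℕ} (f : Fin n → Fin n) → Injective _≡_ _≡_ f → IsPerm (tabulate f)
  tabulate-isPerm f f-inj {i} {j} eq = f-inj (trans (sym (lookup∘tabulate f i)) (trans eq (lookup∘tabulate f j)))

  module _ {n r : ℕ} where

    ω : Elem n r → Fin n → Fin n
    ω g = lookup (proj₁ g)

    τ : Elem n r → Fin n → Fin r
    τ g = lookup (proj₂ g)

    mkElem : (Fin n → Fin n) → (Fin n → Fin r) → Elem n r
    mkElem f t = tabulate f , tabulate t

    Elem-ext : {g h : Elem n r} → (∀ i → ω g i ≡ ω h i) → (∀ j → τ g j ≡ τ h j) → g ≡ h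
    Elem-ext {w , t} {w′ , t′} ω≗ τ≗ = cong₂ _,_
      (trans (sym (tabulate∘lookup w)) (trans (tabulate-cong ω≗) (tabulate∘lookup w′)))
      (trans (sym (tabulate∘lookup t)) (trans (tabulate-cong τ≗) (tabulate∘lookup t′)))

  module _ {n r : ℕ} .{{_ : NonZero r}} where

    identity : Elem n r
    identity = mkElem (λ i → i) (λ _ → 0#)

    act-identity : (p : Fin n × Fin r) → act identity p ≡ p
    act-identity (i , c) = cong₂ _,_ (lookup∘tabulate (λ i → i) i)
      (trans (cong (_⊕ c) (lookup∘tabulate {n = n} (λ _ → 0#) (ω identity i))) (⊕-identityˡ c))

    ConjClass-refl : (g : Elem n r) → IsElem g → ConjClass g g
    ConjClass-refl g g-inj = g-inj , identity , tabulate-isPerm (λ i → i) (λ eq → eq) ,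
      λ i c → trans (cong (act g) (act-identity (i , c))) (sym (act-identity (act g (i , c))))

    -- If D is the action of a group element d and Ψ x acts as d x, then h′ = d h d⁻¹.
    ConjClass-transport : {g h : Elem n r} (h′ : Elem n r) (D : Fin n × Fin r → Fin n × Fin r)
      (Ψ : Elem n r → Elem n r) → IsElem h′ → (∀ x → IsElem x → IsElem (Ψ x)) →
      (∀ p → act h′ (D p) ≡ D (act h p)) → (∀ x p → act (Ψ x) p ≡ D (act x p)) →
      ConjClass g h → ConjClass g h′
    ConjClass-transport {g} {h} h′ D Ψ h′-elem Ψ-elem h′D≡Dh Ψ≡D (_ , x , x-elem , hx≡xg) =
      h′-elem , Ψ x , Ψ-elem x x-elem , λ i c → begin
        act h′ (act (Ψ x) (i , c))  ≡⟨ cong (act h′) (Ψ≡D x (i , c)) ⟩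
        act h′ (D (act x (i , c)))  ≡⟨ h′D≡Dh (act x (i , c)) ⟩
        D (act h (act x (i , c)))   ≡⟨ cong D (hx≡xg i c) ⟩
        D (act x (act g (i , c)))   ≡⟨ Ψ≡D x (act g (i , c)) ⟨
        act (Ψ x) (act g (i , c))   ∎
      where open ≡-Reasoning

    ConjClass-NoShortCycles : {s : ℕ} {g h : Elem n r} → ConjClass g h → NoShortCycles s g → NoShortCycles s h
    ConjClass-NoShortCycles {g = g} {h} (_ , x , x-inj , hx≡xg) g-noShort j p 1≤p p≤s cycle
      with Fin-injective⇒surjective x-inj j
    ... | i , refl = g-noShort i p 1≤p p≤s (x-inj (trans (sym (iter-intertwine (ω h) (ω g) (ω x) hx≡xg′ p i)) cycle))
      where
        hx≡xg′ : ∀ i → ω h (ω x i) ≡ ω x (ω g i)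
        hx≡xg′ i = cong proj₁ (hx≡xg i 0#)

  module _ {n : ℕ} where

    ⟨$⟩ʳ-injective : (π : Permutation n n) → Injective _≡_ _≡_ (π ⟨$⟩ʳ_)
    ⟨$⟩ʳ-injective π eq = trans (sym (inverseˡ π)) (trans (cong (π ⟨$⟩ˡ_) eq) (inverseˡ π))

    transpose-fixes : {i j k : Fin n} → k ≢ i → k ≢ j → transpose i j ⟨$⟩ʳ k ≡ k
    transpose-fixes {i} {j} {k} k≢i k≢j rewrite dec-false (k ≟ i) k≢i | dec-false (k ≟ j) k≢j = refl

    transpose-maps : (i j : Fin n) → transpose i j ⟨$⟩ʳ i ≡ j
    transpose-maps i j rewrite dec-true (i ≟ i) refl = refl

  module _ {n r : ℕ} .{{_ : NonZero r}} where

    relabel : Permutation n n → Elem n r → Elem n r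
    relabel π h = mkElem (λ i → π ⟨$⟩ʳ ω h (π ⟨$⟩ˡ i)) (λ j → τ h (π ⟨$⟩ˡ j))

    module _ (π : Permutation n n) where

      ω-relabel : (h : Elem n r) (i : Fin n) → ω (relabel π h) (π ⟨$⟩ʳ i) ≡ π ⟨$⟩ʳ ω h i
      ω-relabel h i = trans (lookup∘tabulate (λ k → π ⟨$⟩ʳ ω h (π ⟨$⟩ˡ k)) (π ⟨$⟩ʳ i))
        (cong (λ k → π ⟨$⟩ʳ ω h k) (inverseˡ π))

      τ-relabel : (h : Elem n r) (j : Fin n) → τ (relabel π h) (π ⟨$⟩ʳ j) ≡ τ h j
      τ-relabel h j = trans (lookup∘tabulate (λ k → τ h (π ⟨$⟩ˡ k)) (π ⟨$⟩ʳ j)) (cong (τ h) (inverseˡ π))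

      relabel-ConjClass : {g h : Elem n r} → ConjClass g h → ConjClass g (relabel π h)
      relabel-ConjClass {g} {h} h∈C = ConjClass-transport {g = g} {h} (relabel π h) D Ψ
        (tabulate-isPerm (λ i → π ⟨$⟩ʳ ω h (π ⟨$⟩ˡ i)) λ eq →
          trans (sym (inverseʳ π)) (trans (cong (π ⟨$⟩ʳ_) (proj₁ h∈C (⟨$⟩ʳ-injective π eq))) (inverseʳ π)))
        (λ x x-inj → tabulate-isPerm (λ i → π ⟨$⟩ʳ ω x i) (λ eq → x-inj (⟨$⟩ʳ-injective π eq)))
        (λ (p , q) → cong₂ _,_ (ω-relabel h p)
          (cong (_⊕ q) (trans (cong (τ (relabel π h)) (ω-relabel h p)) (τ-relabel h (ω h p)))))
        (λ x (i , c) → cong₂ _,_ (ω-Ψ x i) (cong (_⊕ c) (trans (cong (τ (Ψ x)) (ω-Ψ x i))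
          (trans (lookup∘tabulate (λ j → τ x (π ⟨$⟩ˡ j)) _) (cong (τ x) (inverseˡ π))))))
        h∈C
        where
          D : Fin n × Fin r → Fin n × Fin r
          D (p , q) = π ⟨$⟩ʳ p , q
          Ψ : Elem n r → Elem n r
          Ψ x = mkElem (λ i → π ⟨$⟩ʳ ω x i) (λ j → τ x (π ⟨$⟩ˡ j))
          ω-Ψ : ∀ x i → ω (Ψ x) i ≡ π ⟨$⟩ʳ ω x i
          ω-Ψ x = lookup∘tabulate (λ i → π ⟨$⟩ʳ ω x i)

      relabel-flip : (h : Elem n r) → relabel (flip π) (relabel π h) ≡ h
      relabel-flip h = Elem-ext
        (λ i → trans (lookup∘tabulate (λ k → π ⟨$⟩ˡ ω (relabel π h) (π ⟨$⟩ʳ k)) i)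
          (trans (cong (π ⟨$⟩ˡ_) (ω-relabel h i)) (inverseˡ π)))
        (λ j → trans (lookup∘tabulate (λ k → τ (relabel π h) (π ⟨$⟩ʳ k)) j) (τ-relabel h j))

      satisfiesEntry-relabel : (h : Elem n r) (i j : Fin n) (c : Fin r) →
        satisfiesEntry (relabel π h) (π ⟨$⟩ʳ i , π ⟨$⟩ʳ j , c) ≡ satisfiesEntry h (i , j , c)
      satisfiesEntry-relabel h i j c = cong₂ _∧_
        (trans (cong (λ k → does (k ≟ π ⟨$⟩ʳ j)) (ω-relabel h i))
          (does-≟-injective _≟_ _≟_ (⟨$⟩ʳ-injective π) (ω h i) j))
        (cong (λ k → does (k ≟ c)) (τ-relabel h j))

    flip-relabel : (π : Permutation n n) (h : Elem n r) → relabel π (relabel (flip π) h) ≡ h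
    flip-relabel π = relabel-flip (flip π)

  module _ {n r : ℕ} .{{_ : NonZero r}} where

    shiftedColours : Fin n → Fin r → Elem n r → Fin n → Fin r
    shiftedColours b d h j =
      if does (j ≟ b) then τ h j ⊕ d else if does (j ≟ ω h b) then τ h j ⊕ (⊖ d) else τ h j

    -- Conjugation by the element (id, colour d at b); it has this form only when h b ≢ b.
    shiftColour : Fin n → Fin r → Elem n r → Elem n r
    shiftColour b d h = mkElem (ω h) (shiftedColours b d h)

    module _ (b : Fin n) (d : Fin r) where

      ω-shiftColour : (h : Elem n r) (i : Fin n) → ω (shiftColour b d h) i ≡ ω h i
      ω-shiftColour h = lookup∘tabulate (ω h)

      τ-shiftColour-at : (h : Elem n r) → τ (shiftColour b d h) b ≡ τ h b ⊕ d
      τ-shiftColour-at h rewrite lookup∘tabulate (shiftedColours b d h) b | dec-true (b ≟ b) refl = refl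

      τ-shiftColour-image : (h : Elem n r) → ω h b ≢ b → τ (shiftColour b d h) (ω h b) ≡ τ h (ω h b) ⊕ (⊖ d)
      τ-shiftColour-image h hb≢b rewrite lookup∘tabulate (shiftedColours b d h) (ω h b)
        | dec-false (ω h b ≟ b) hb≢b | dec-true (ω h b ≟ ω h b) refl = refl

      τ-shiftColour-other : (h : Elem n r) {j : Fin n} → j ≢ b → j ≢ ω h b → τ (shiftColour b d h) j ≡ τ h j
      τ-shiftColour-other h {j} j≢b j≢hb rewrite lookup∘tabulate (shiftedColours b d h) j
        | dec-false (j ≟ b) j≢b | dec-false (j ≟ ω h b) j≢hb = refl

      shiftColour-ConjClass : {g h : Elem n r} → ω h b ≢ b → ConjClass g h → ConjClass g (shiftColour b d h)
      shiftColour-ConjClass {g} {h} hb≢b h∈C = ConjClass-transport {g = g} {h} (shiftColour b d h) D Ψ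
        (λ eq → proj₁ h∈C (trans (sym (ω-shiftColour h _)) (trans eq (ω-shiftColour h _))))
        (λ x x-inj → tabulate-isPerm (ω x) x-inj)
        conjugate Ψ≡D h∈C
        where
          D : Fin n × Fin r → Fin n × Fin r
          D (p , q) = p , (if does (p ≟ b) then d ⊕ q else q)
          Ψ-colours : Elem n r → Fin n → Fin r
          Ψ-colours x j = if does (j ≟ b) then d ⊕ τ x j else τ x j
          Ψ : Elem n r → Elem n r
          Ψ x = mkElem (ω x) (Ψ-colours x)
          Ψ≡D : ∀ x p → act (Ψ x) p ≡ D (act x p)
          Ψ≡D x (i , c) rewrite lookup∘tabulate (ω x) i | lookup∘tabulate (Ψ-colours x) (ω x i) with ω x i ≟ b
          ... | yes _ = cong (ω x i ,_) (⊕-assoc d (τ x (ω x i)) c)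
          ... | no _  = refl
          conjugate : ∀ p → act (shiftColour b d h) (D p) ≡ D (act h p)
          conjugate (p , q) with p ≟ b
          ... | yes refl rewrite ω-shiftColour h b | τ-shiftColour-image h hb≢b | dec-false (ω h b ≟ b) hb≢b =
            cong (ω h b ,_) (begin
              (τ h (ω h b) ⊕ (⊖ d)) ⊕ (d ⊕ q) ≡⟨ ⊕-assoc (τ h (ω h b) ⊕ (⊖ d)) d q ⟨
              ((τ h (ω h b) ⊕ (⊖ d)) ⊕ d) ⊕ q ≡⟨ cong (_⊕ q) (⊖⊕-cancel (τ h (ω h b)) d) ⟩
              τ h (ω h b) ⊕ q                 ∎)
            where open ≡-Reasoning
          ... | no p≢b rewrite ω-shiftColour h p with ω h p ≟ b
          ...   | yes refl rewrite τ-shiftColour-at h = cong (b ,_) (begin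
              (τ h b ⊕ d) ⊕ q ≡⟨ cong (_⊕ q) (⊕-comm (τ h b) d) ⟩
              (d ⊕ τ h b) ⊕ q ≡⟨ ⊕-assoc d (τ h b) q ⟩
              d ⊕ (τ h b ⊕ q) ∎)
            where open ≡-Reasoning
          ...   | no hp≢b rewrite τ-shiftColour-other h hp≢b (λ hp≡hb → p≢b (proj₁ h∈C hp≡hb)) = refl

      satisfiesEntry-shiftColour-target : (h : Elem n r) (a : Fin n) (c : Fin r) →
        satisfiesEntry (shiftColour b d h) (a , b , c ⊕ d) ≡ satisfiesEntry h (a , b , c)
      satisfiesEntry-shiftColour-target h a c = cong₂ _∧_
        (cong (λ k → does (k ≟ b)) (ω-shiftColour h a))
        (trans (cong (λ k → does (k ≟ c ⊕ d)) (τ-shiftColour-at h))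
          (does-≟-injective _≟_ _≟_ (λ {x} {y} → ⊕-cancelʳ x y d) (τ h b) c))

      satisfiesEntry-shiftColour-away : (h : Elem n r) → IsElem h → {i j : Fin n} (c : Fin r) → i ≢ b → j ≢ b →
        satisfiesEntry (shiftColour b d h) (i , j , c) ≡ satisfiesEntry h (i , j , c)
      satisfiesEntry-shiftColour-away h h-inj {i} {j} c i≢b j≢b rewrite ω-shiftColour h i with ω h i ≟ j
      ... | no _     = refl
      ... | yes refl rewrite τ-shiftColour-other h j≢b (λ hi≡hb → i≢b (h-inj hi≡hb)) = refl

    shiftColour-⊖ : (b : Fin n) (d : Fin r) (h : Elem n r) → shiftColour b (⊖ d) (shiftColour b d h) ≡ h
    shiftColour-⊖ b d h = Elem-ext (λ i → trans (ω-shiftColour b (⊖ d) h′ i) (ω-shiftColour b d h i)) τ-inverse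
      where
        h′ : Elem n r
        h′ = shiftColour b d h
        h′b≡hb : ω h′ b ≡ ω h b
        h′b≡hb = ω-shiftColour b d h b
        τ-inverse : ∀ j → τ (shiftColour b (⊖ d) h′) j ≡ τ h j
        τ-inverse j with j ≟ b
        ... | yes refl = begin
          τ (shiftColour b (⊖ d) h′) b          ≡⟨ τ-shiftColour-at b (⊖ d) h′ ⟩
          τ h′ b ⊕ (⊖ d)                        ≡⟨ cong (_⊕ (⊖ d)) (τ-shiftColour-at b d h) ⟩
          (τ h b ⊕ d) ⊕ (⊖ d)                   ≡⟨ ⊕⊖-cancel (τ h b) d ⟩
          τ h b                                 ∎
          where open ≡-Reasoning
        ... | no j≢b with j ≟ ω h b
        ...   | yes refl = begin
          τ (shiftColour b (⊖ d) h′) (ω h b)    ≡⟨ cong (τ (shiftColour b (⊖ d) h′)) h′b≡hb ⟨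
          τ (shiftColour b (⊖ d) h′) (ω h′ b)   ≡⟨ τ-shiftColour-image b (⊖ d) h′ h′b≢b ⟩
          τ h′ (ω h′ b) ⊕ (⊖ ⊖ d)               ≡⟨ cong (λ k → τ h′ k ⊕ (⊖ ⊖ d)) h′b≡hb ⟩
          τ h′ (ω h b) ⊕ (⊖ ⊖ d)                ≡⟨ cong (_⊕ (⊖ ⊖ d)) (τ-shiftColour-image b d h j≢b) ⟩
          (τ h (ω h b) ⊕ (⊖ d)) ⊕ (⊖ ⊖ d)       ≡⟨ ⊕⊖-cancel (τ h (ω h b)) (⊖ d) ⟩
          τ h (ω h b)                           ∎
          where
            open ≡-Reasoning
            h′b≢b : ω h′ b ≢ b
            h′b≢b h′b≡b = j≢b (trans (sym h′b≡hb) h′b≡b)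
        ...   | no j≢hb = trans (τ-shiftColour-other b (⊖ d) h′ j≢b (λ j≡h′b → j≢hb (trans j≡h′b h′b≡hb)))
                                (τ-shiftColour-other b d h j≢b j≢hb)

    ⊖-shiftColour : (b : Fin n) (d : Fin r) (h : Elem n r) → shiftColour b d (shiftColour b (⊖ d) h) ≡ h
    ⊖-shiftColour b d h =
      subst (λ e → shiftColour b e (shiftColour b (⊖ d) h) ≡ h) (⊖-involutive d) (shiftColour-⊖ b (⊖ d) h)

module Counting where

  open Sums
  open Colours
  open ColouredPermutations
  open import Data.Bool using (Bool; true; false; T; _∧_; if_then_else_)
  open import Data.Bool.Properties using (∧-assoc)
  open import Data.Fin using (Fin; _≟_)
  open import Data.Fin.Permutation using (Permutation; _⟨$⟩ʳ_; flip; transpose)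
  open import Data.List using (List; []; _∷_; allFin; map; length)
  open import Data.List.Membership.Propositional using (_∈_)
  open import Data.List.Membership.Propositional.Properties using (∈-allFin; ∈-map⁺; ∈-map⁻)
  open import Data.List.Properties using (length-tabulate)
  open import Data.List.Relation.Unary.Any using (Any; here; there)
  open import Data.List.Relation.Unary.Unique.Propositional.Properties as Unique using (allFin⁺)
  open import Data.Nat using (ℕ; _*_; _≤_; NonZero)
  open import Data.Nat.Properties using (≤-refl; *-identityʳ)
  open import Data.Product using (_×_; _,_; proj₁; proj₂)
  open import Data.Sum using (_⊎_; inj₁; inj₂)
  open import Data.Unit using (tt)
  open import Function using (id)
  open import Function.Bundles using (Equivalence; mk⇔)
  open import Relation.Binary.PropositionalEquality
  open import Relation.Nullary using (does; ¬_; contradiction)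

  𝟙 : Bool → ℕ
  𝟙 true  = 1
  𝟙 false = 0

  Entry : ℕ → ℕ → Set
  Entry n r = Fin n × Fin n × Fin r

  module _ {n r : ℕ} where

    src tgt : Entry n r → Fin n
    src (i , _ , _) = i
    tgt (_ , j , _) = j

    col : Entry n r → Fin r
    col (_ , _ , c) = c

    _occursIn_ : Fin n → List (Entry n r) → Set
    v occursIn E = Any (λ e → v ≡ src e ⊎ v ≡ tgt e) E

    FreshTarget : Fin n → List (Entry n r) → Fin n → Set
    FreshTarget a E b = b ≢ a × ¬ (b occursIn E)

  module _ {n r : ℕ} .{{_ : NonZero r}} where

    sat : Elem n r → List (Entry n r) → Bool
    sat h E = allB (satisfiesEntry h) E

    #sat : List (Elem n r) → List (Entry n r) → ℕ
    #sat L E = sumℕ (λ h → 𝟙 (sat h E)) L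

    #sat-[] : (L : List (Elem n r)) → #sat L [] ≡ length L
    #sat-[] L = trans (sumℕ-const 1 L) (*-identityʳ (length L))

    #sat-none : (L : List (Elem n r)) (E : List (Entry n r)) → (∀ h → h ∈ L → ¬ T (sat h E)) → #sat L E ≡ 0
    #sat-none L E unsat = trans (sumℕ-cong L (λ h h∈L → 𝟙-false (unsat h h∈L))) (sumℕ-zero L)
      where
        𝟙-false : ∀ {b} → ¬ T b → 𝟙 b ≡ 0
        𝟙-false {false} _  = refl
        𝟙-false {true}  ¬t = contradiction tt ¬t

    sat-relabel-fixing : (π : Permutation n n) (h : Elem n r) (E : List (Entry n r)) →
      (∀ v → v occursIn E → π ⟨$⟩ʳ v ≡ v) → sat (relabel π h) E ≡ sat h E
    sat-relabel-fixing π h []                fixes = refl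
    sat-relabel-fixing π h ((i , j , c) ∷ E) fixes = cong₂ _∧_
      (subst₂ (λ i′ j′ → satisfiesEntry (relabel π h) (i′ , j′ , c) ≡ satisfiesEntry h (i , j , c))
        (fixes i (here (inj₁ refl))) (fixes j (here (inj₂ refl))) (satisfiesEntry-relabel π h i j c))
      (sat-relabel-fixing π h E (λ v v∈E → fixes v (there v∈E)))

    sat-shiftColour-away : (b : Fin n) (d : Fin r) (h : Elem n r) → IsElem h → (E : List (Entry n r)) →
      ¬ (b occursIn E) → sat (shiftColour b d h) E ≡ sat h E
    sat-shiftColour-away b d h h-inj []                b∉E = refl
    sat-shiftColour-away b d h h-inj ((i , j , c) ∷ E) b∉E = cong₂ _∧_
      (satisfiesEntry-shiftColour-away b d h h-inj c (λ i≡b → b∉E (here (inj₁ (sym i≡b))))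
        (λ j≡b → b∉E (here (inj₂ (sym j≡b)))))
      (sat-shiftColour-away b d h h-inj E (λ b∈E → b∉E (there b∈E)))

    private
      𝟙-∧ : ∀ x y → 𝟙 (x ∧ y) ≡ (if x then 𝟙 y else 0)
      𝟙-∧ true  y = refl
      𝟙-∧ false y = refl

    -- Only (b , c) = (ω h a , τ h (ω h a)) can make the new entry (a , b , c) true of h.
    sat-choices : (h : Elem n r) (a : Fin n) (E : List (Entry n r)) →
      sumℕ (λ b → sumℕ (λ c → 𝟙 (sat h ((a , b , c) ∷ E))) (allFin r)) (allFin n) ≡ 𝟙 (sat h E)
    sat-choices h a E = begin
      sumℕ (λ b → sumℕ (λ c → 𝟙 (sat h ((a , b , c) ∷ E))) (allFin r)) (allFin n)
        ≡⟨ sumℕ-cong (allFin n) (λ b _ → trans (sumℕ-cong (allFin r) (λ c _ → split b c))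
             (sumℕ-if (does (ω h a ≟ b)) _ (allFin r))) ⟩
      sumℕ (λ b → if does (ω h a ≟ b) then sumℕ (λ c → if does (τ h b ≟ c) then S else 0) (allFin r) else 0)
        (allFin n)
        ≡⟨ sumℕ-cong (allFin n) (λ b _ → cong (λ k → if does (ω h a ≟ b) then k else 0)
             (sumℕ-δ _≟_ (λ _ → S) (allFin r) (allFin⁺ r) (∈-allFin (τ h b)))) ⟩
      sumℕ (λ b → if does (ω h a ≟ b) then S else 0) (allFin n)
        ≡⟨ sumℕ-δ _≟_ (λ _ → S) (allFin n) (allFin⁺ n) (∈-allFin (ω h a)) ⟩
      S ∎
      where
        open ≡-Reasoning
        S : ℕ
        S = 𝟙 (sat h E)
        split : ∀ b c →
          𝟙 (sat h ((a , b , c) ∷ E)) ≡ (if does (ω h a ≟ b) then (if does (τ h b ≟ c) then S else 0) else 0)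
        split b c = begin
          𝟙 ((does (ω h a ≟ b) ∧ does (τ h b ≟ c)) ∧ sat h E)  ≡⟨ cong 𝟙 (∧-assoc (does (ω h a ≟ b)) _ _) ⟩
          𝟙 (does (ω h a ≟ b) ∧ (does (τ h b ≟ c) ∧ sat h E))  ≡⟨ 𝟙-∧ (does (ω h a ≟ b)) _ ⟩
          _                                                     ≡⟨ cong (λ k → if does (ω h a ≟ b) then k else 0)
                                                                     (𝟙-∧ (does (τ h b ≟ c)) _) ⟩
          _                                                     ∎

    #sat-choices : (L : List (Elem n r)) (a : Fin n) (E : List (Entry n r)) →
      #sat L E ≡ sumℕ (λ b → sumℕ (λ c → #sat L ((a , b , c) ∷ E)) (allFin r)) (allFin n)
    #sat-choices L a E = begin
      #sat L E
        ≡⟨ sumℕ-cong L (λ h _ → sym (sat-choices h a E)) ⟩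
      sumℕ (λ h → sumℕ (λ b → sumℕ (λ c → 𝟙 (sat h ((a , b , c) ∷ E))) (allFin r)) (allFin n)) L
        ≡⟨ sumℕ-comm (λ h b → sumℕ (λ c → 𝟙 (sat h ((a , b , c) ∷ E))) (allFin r)) L (allFin n) ⟩
      sumℕ (λ b → sumℕ (λ h → sumℕ (λ c → 𝟙 (sat h ((a , b , c) ∷ E))) (allFin r)) L) (allFin n)
        ≡⟨ sumℕ-cong (allFin n) (λ b _ → sumℕ-comm (λ h c → 𝟙 (sat h ((a , b , c) ∷ E))) L (allFin r)) ⟩
      sumℕ (λ b → sumℕ (λ c → #sat L ((a , b , c) ∷ E)) (allFin r)) (allFin n)
        ∎
      where open ≡-Reasoning

  module ClassCounts {n r : ℕ} .{{_ : NonZero r}} {s : ℕ} (1≤s : 1 ≤ s) (g : Elem n r)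
    (g-noShort : NoShortCycles s g) (L : List (Elem n r)) (L-enum : Enumerates L (ConjClass g)) where

    member⇒ConjClass : {h : Elem n r} → h ∈ L → ConjClass g h
    member⇒ConjClass {h} = Equivalence.to (proj₂ L-enum h)

    ConjClass⇒member : {h : Elem n r} → ConjClass g h → h ∈ L
    ConjClass⇒member {h} = Equivalence.from (proj₂ L-enum h)

    class-noShortCycles : {h : Elem n r} → ConjClass g h → NoShortCycles s h
    class-noShortCycles {h} h∈C = ConjClass-NoShortCycles {g = g} {h} h∈C g-noShort

    class-noFixedPoint : {h : Elem n r} → ConjClass g h → (b : Fin n) → ω h b ≢ b
    class-noFixedPoint {h} h∈C b = class-noShortCycles {h} h∈C b 1 ≤-refl 1≤s

    #sat-unsat : (E : List (Entry n r)) → (∀ h → IsElem h → NoShortCycles s h → ¬ T (sat h E)) → #sat L E ≡ 0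
    #sat-unsat E unsat = #sat-none L E λ h h∈L →
      unsat h (proj₁ (member⇒ConjClass {h} h∈L)) (class-noShortCycles {h} (member⇒ConjClass {h} h∈L))

    sumℕ-conjugate : (f : Elem n r → ℕ) (φ ψ : Elem n r → Elem n r) →
      (∀ {h} → ConjClass g h → ConjClass g (φ h)) → (∀ {h} → ConjClass g h → ConjClass g (ψ h)) →
      (∀ h → ψ (φ h) ≡ h) → (∀ h → φ (ψ h) ≡ h) → sumℕ (λ h → f (φ h)) L ≡ sumℕ f L
    sumℕ-conjugate f φ ψ φ∈C ψ∈C ψφ≡id φψ≡id = begin
      sumℕ (λ h → f (φ h)) L ≡⟨ sumℕ-map f φ L ⟨
      sumℕ f (map φ L)       ≡⟨ sumℕ-set-equal f (Unique.map⁺ φ-injective (proj₁ L-enum)) (proj₁ L-enum) (mk⇔ to from) ⟩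
      sumℕ f L               ∎
      where
        open ≡-Reasoning
        φ-injective : ∀ {h h′} → φ h ≡ φ h′ → h ≡ h′
        φ-injective {h} {h′} eq = trans (sym (ψφ≡id h)) (trans (cong ψ eq) (ψφ≡id h′))
        to : ∀ {h} → h ∈ map φ L → h ∈ L
        to h∈φL with ∈-map⁻ φ h∈φL
        ... | h′ , h′∈L , refl = ConjClass⇒member (φ∈C (member⇒ConjClass h′∈L))
        from : ∀ {h} → h ∈ L → h ∈ map φ L
        from {h} h∈L = subst (_∈ map φ L) (φψ≡id h) (∈-map⁺ φ (ConjClass⇒member (ψ∈C (member⇒ConjClass h∈L))))

    #sat-conjugate : (φ ψ : Elem n r → Elem n r) →
      (∀ {h} → ConjClass g h → ConjClass g (φ h)) → (∀ {h} → ConjClass g h → ConjClass g (ψ h)) →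
      (∀ h → ψ (φ h) ≡ h) → (∀ h → φ (ψ h) ≡ h) →
      (E E′ : List (Entry n r)) → (∀ h → h ∈ L → sat (φ h) E ≡ sat h E′) → #sat L E ≡ #sat L E′
    #sat-conjugate φ ψ φ∈C ψ∈C ψφ≡id φψ≡id E E′ sat≡ = begin
      #sat L E                           ≡⟨ sumℕ-conjugate (λ h → 𝟙 (sat h E)) φ ψ φ∈C ψ∈C ψφ≡id φψ≡id ⟨
      sumℕ (λ h → 𝟙 (sat (φ h) E)) L     ≡⟨ sumℕ-cong L (λ h h∈L → cong 𝟙 (sat≡ h h∈L)) ⟩
      #sat L E′                          ∎
      where open ≡-Reasoning

    #sat-colour-shift : (a b : Fin n) (E : List (Entry n r)) → ¬ (b occursIn E) → (c d : Fin r) →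
      #sat L ((a , b , c ⊕ d) ∷ E) ≡ #sat L ((a , b , c) ∷ E)
    #sat-colour-shift a b E b∉E c d = #sat-conjugate (shiftColour b d) (shiftColour b (⊖ d))
      (λ {h} h∈C → shiftColour-ConjClass b d {g} {h} (class-noFixedPoint {h} h∈C b) h∈C)
      (λ {h} h∈C → shiftColour-ConjClass b (⊖ d) {g} {h} (class-noFixedPoint {h} h∈C b) h∈C)
      (shiftColour-⊖ b d) (⊖-shiftColour b d) ((a , b , c ⊕ d) ∷ E) ((a , b , c) ∷ E)
      λ h h∈L → cong₂ _∧_ (satisfiesEntry-shiftColour-target b d h a c)
        (sat-shiftColour-away b d h (proj₁ (member⇒ConjClass {h} h∈L)) E b∉E)

    #sat-colour-independent : (a b : Fin n) (E : List (Entry n r)) → ¬ (b occursIn E) → (c c₀ : Fin r) →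
      #sat L ((a , b , c) ∷ E) ≡ #sat L ((a , b , c₀) ∷ E)
    #sat-colour-independent a b E b∉E c c₀ =
      trans (cong (λ k → #sat L ((a , b , k) ∷ E)) c≡c₀⊕[c⊖c₀]) (#sat-colour-shift a b E b∉E c₀ (c ⊕ (⊖ c₀)))
      where
        c≡c₀⊕[c⊖c₀] : c ≡ c₀ ⊕ (c ⊕ (⊖ c₀))
        c≡c₀⊕[c⊖c₀] = sym (trans (⊕-comm c₀ _) (⊖⊕-cancel c c₀))

    #sat-target-swap : (a b b′ : Fin n) (E : List (Entry n r)) → FreshTarget a E b → FreshTarget a E b′ →
      (c : Fin r) → #sat L ((a , b′ , c) ∷ E) ≡ #sat L ((a , b , c) ∷ E)
    #sat-target-swap a b b′ E (b≢a , b∉E) (b′≢a , b′∉E) c = #sat-conjugate (relabel π) (relabel (flip π))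
      (λ {h} → relabel-ConjClass π {g} {h}) (λ {h} → relabel-ConjClass (flip π) {g} {h})
      (relabel-flip π) (flip-relabel π) ((a , b′ , c) ∷ E) ((a , b , c) ∷ E)
      λ h _ → cong₂ _∧_
        (subst₂ (λ a′ b″ → satisfiesEntry (relabel π h) (a′ , b″ , c) ≡ satisfiesEntry h (a , b , c))
          π-fixes-a (transpose-maps b b′) (satisfiesEntry-relabel π h a b c))
        (sat-relabel-fixing π h E π-fixes-E)
      where
        π : Permutation n n
        π = transpose b b′
        π-fixes-a : π ⟨$⟩ʳ a ≡ a
        π-fixes-a = transpose-fixes (λ a≡b → b≢a (sym a≡b)) (λ a≡b′ → b′≢a (sym a≡b′))
        π-fixes-E : ∀ v → v occursIn E → π ⟨$⟩ʳ v ≡ v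
        π-fixes-E v v∈E = transpose-fixes (λ v≡b → b∉E (subst (_occursIn E) v≡b v∈E))
          (λ v≡b′ → b′∉E (subst (_occursIn E) v≡b′ v∈E))

    #sat-fresh-independent : (a b b₀ : Fin n) (E : List (Entry n r)) → FreshTarget a E b → FreshTarget a E b₀ →
      (c c₀ : Fin r) → #sat L ((a , b , c) ∷ E) ≡ #sat L ((a , b₀ , c₀) ∷ E)
    #sat-fresh-independent a b b₀ E b-fresh b₀-fresh c c₀ =
      trans (#sat-target-swap a b₀ b E b₀-fresh b-fresh c) (#sat-colour-independent a b₀ E (proj₂ b₀-fresh) c c₀)

    #sat-fresh-colours : (a b b₀ : Fin n) (E : List (Entry n r)) → FreshTarget a E b → FreshTarget a E b₀ →
      (c₀ : Fin r) → sumℕ (λ c → #sat L ((a , b , c) ∷ E)) (allFin r) ≡ r * #sat L ((a , b₀ , c₀) ∷ E)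
    #sat-fresh-colours a b b₀ E b-fresh b₀-fresh c₀ = begin
      sumℕ (λ c → #sat L ((a , b , c) ∷ E)) (allFin r)
        ≡⟨ sumℕ-cong (allFin r) (λ c _ → #sat-fresh-independent a b b₀ E b-fresh b₀-fresh c c₀) ⟩
      sumℕ (λ _ → #sat L E°) (allFin r)   ≡⟨ sumℕ-const _ (allFin r) ⟩
      length (allFin r) * #sat L E°       ≡⟨ cong (_* #sat L E°) (length-tabulate {n = r} id) ⟩
      r * #sat L E°                       ∎
      where
        open ≡-Reasoning
        E° : List (Entry n r)
        E° = (a , b₀ , c₀) ∷ E

module Density where

  open Sums
  open ColouredPermutations
  open Counting
  open import Data.Bool using (Bool; true; false; T; _∧_)
  open import Data.Bool.Properties using (∧-assoc; ∧-comm; ∧-zeroʳ; T-∧; T-≡)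
  open import Data.Empty using (⊥)
  open import Data.Fin using (Fin; toℕ; _≟_) renaming (_<_ to _<ᶠ_)
  open import Data.Fin.Properties using (pigeonhole; toℕ<n)
  open import Data.List using (List; []; _∷_; map; length; allFin; lookup)
  open import Data.List.Membership.Propositional using (_∈_; _∉_; find)
  open import Data.List.Membership.Propositional.Properties using (∈-map⁺; ∈-map⁻; ∈-allFin)
  open import Data.List.Properties using (length-map; length-tabulate)
  open import Data.List.Relation.Binary.Permutation.Propositional using (_↭_; refl; prep; swap; trans; ↭-sym)
  open import Data.List.Relation.Binary.Permutation.Propositional.Properties using (Any-resp-↭; ↭-length)
  open import Data.List.Relation.Unary.Any using (here; there; index; any?)
  open import Data.List.Relation.Unary.Any.Properties using (lookup-index)
  open import Data.Nat using (ℕ; zero; suc; _+_; _*_; _∸_; _≤_; _<_; z≤n; s≤s; s≤s⁻¹; NonZero)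
  open import Data.Nat.Induction using (<-wellFounded)
  open import Data.Nat.Properties hiding (_≟_)
  open import Data.Product using (_×_; _,_; proj₁; proj₂; ∃; ∃₂)
  open import Data.Product.Properties using (≡-dec)
  open import Data.Sum using (_⊎_; inj₁; inj₂)
  open import Data.Unit using (tt)
  open import Function using (id)
  open import Function.Bundles using (Equivalence)
  open import Induction.WellFounded using (Acc; acc)
  open import Relation.Binary.PropositionalEquality as ≡ using (_≡_; cong; cong₂; sym; subst)
  open import Relation.Nullary using (Dec; yes; no; does; ¬_; contradiction)
  open import Relation.Nullary.Decidable using (_⊎-dec_; _×-dec_; ¬?)

  private variable A : Set

  data Pick {A : Set} : List A → A → List A → Set where
    here  : ∀ {x xs} → Pick (x ∷ xs) x xs
    there : ∀ {x xs e rest} → Pick xs e rest → Pick (x ∷ xs) e (x ∷ rest)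

  Pick⇒↭ : ∀ {E e rest} → Pick {A} E e rest → E ↭ e ∷ rest
  Pick⇒↭ here                     = refl
  Pick⇒↭ (there {x} {e = e} pick) = trans (prep x (Pick⇒↭ pick)) (swap x e refl)

  ∈⇒Pick : ∀ {x : A} {E} → x ∈ E → ∃ λ rest → Pick E x rest
  ∈⇒Pick (here ≡.refl) = _ , here
  ∈⇒Pick (there x∈E) with ∈⇒Pick x∈E
  ... | rest , pick = _ , there pick

  Pick-⊆ : ∀ {E e rest x} → Pick {A} E e rest → x ∈ rest → x ∈ E
  Pick-⊆ pick x∈rest = Any-resp-↭ (↭-sym (Pick⇒↭ pick)) (there x∈rest)

  pick? : (Q : A → List A → Set) → (∀ e rest → Dec (Q e rest)) → (E : List A) →
    (∃₂ λ e rest → Pick E e rest × Q e rest) ⊎ (∀ {e rest} → Pick E e rest → ¬ Q e rest)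
  pick? Q Q? []       = inj₂ λ ()
  pick? Q Q? (x ∷ xs) with Q? x xs
  ... | yes q = inj₁ (x , xs , here , q)
  ... | no ¬q with pick? (λ e rest → Q e (x ∷ rest)) (λ e rest → Q? e (x ∷ rest)) xs
  ...   | inj₁ (e , rest , pick , q) = inj₁ (e , x ∷ rest , there pick , q)
  ...   | inj₂ none                  = inj₂ λ { here → ¬q ; (there pick) → none pick }

  iter-+ : (f : A → A) (p q : ℕ) (x : A) → iter f (p + q) x ≡ iter f p (iter f q x)
  iter-+ f zero    q x = ≡.refl
  iter-+ f (suc p) q x = cong f (iter-+ f p q x)

  -- Pigeonhole on the first length xs + 1 points of the orbit of x₀.
  closed⇒cycle : (f : A → A) (xs : List A) {x₀ : A} → x₀ ∈ xs → (∀ {x} → x ∈ xs → f x ∈ xs) →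
    ∃₂ λ x p → 1 ≤ p × p ≤ length xs × iter f p x ≡ x
  closed⇒cycle f xs {x₀} x₀∈xs closed = cycle-from (pigeonhole ≤-refl position)
    where
      orbit : ∀ k → iter f k x₀ ∈ xs
      orbit zero    = x₀∈xs
      orbit (suc k) = closed (orbit k)
      position : Fin (suc (length xs)) → Fin (length xs)
      position k = index (orbit (toℕ k))
      iter-at : ∀ k → iter f (toℕ k) x₀ ≡ lookup xs (position k)
      iter-at k = lookup-index (orbit (toℕ k))
      cycle-from : (∃₂ λ i j → i <ᶠ j × position i ≡ position j) →
        ∃₂ λ x p → 1 ≤ p × p ≤ length xs × iter f p x ≡ x
      cycle-from (i , j , i<j , same-position) = iter f (toℕ i) x₀ , toℕ j ∸ toℕ i , m<n⇒0<n∸m i<j ,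
        ≤-trans (m∸n≤m (toℕ j) (toℕ i)) (s≤s⁻¹ (toℕ<n j)) , (begin
          iter f (toℕ j ∸ toℕ i) (iter f (toℕ i) x₀) ≡⟨ iter-+ f (toℕ j ∸ toℕ i) (toℕ i) x₀ ⟨
          iter f (toℕ j ∸ toℕ i + toℕ i) x₀          ≡⟨ cong (λ k → iter f k x₀) (m∸n+n≡m (<⇒≤ i<j)) ⟩
          iter f (toℕ j) x₀                          ≡⟨ iter-at j ⟩
          lookup xs (position j)                     ≡⟨ cong (lookup xs) same-position ⟨
          lookup xs (position i)                     ≡⟨ iter-at i ⟨
          iter f (toℕ i) x₀                          ∎)
        where open ≡.≡-Reasoning

  allB-∈ : (p : A → Bool) {xs : List A} {x : A} → T (allB p xs) → x ∈ xs → T (p x)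
  allB-∈ p {x ∷ xs} t (here ≡.refl) = proj₁ (Equivalence.to (T-∧ {p x}) t)
  allB-∈ p {x ∷ xs} t (there x∈xs)  = allB-∈ p (proj₂ (Equivalence.to (T-∧ {p x}) t)) x∈xs

  T-does : {P : Set} {d : Dec P} → T (does d) → P
  T-does {d = yes p} _ = p

  module _ {n r : ℕ} .{{_ : NonZero r}} where

    sat-↭ : (h : Elem n r) {E E′ : List (Entry n r)} → E ↭ E′ → sat h E ≡ sat h E′
    sat-↭ h refl                = ≡.refl
    sat-↭ h (prep e E↭E′)       = cong (satisfiesEntry h e ∧_) (sat-↭ h E↭E′)
    sat-↭ h (swap e e′ E↭E′)    = ≡.trans (cong (λ S → x ∧ (y ∧ S)) (sat-↭ h E↭E′)) (begin
      x ∧ (y ∧ _) ≡⟨ ∧-assoc x y _ ⟨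
      (x ∧ y) ∧ _ ≡⟨ cong (_∧ _) (∧-comm x y) ⟩
      (y ∧ x) ∧ _ ≡⟨ ∧-assoc y x _ ⟩
      y ∧ (x ∧ _) ∎)
      where
        open ≡.≡-Reasoning
        x y : Bool
        x = satisfiesEntry h e
        y = satisfiesEntry h e′
    sat-↭ h (trans E↭E′ E′↭E″) = ≡.trans (sat-↭ h E↭E′) (sat-↭ h E′↭E″)

    sat-drop-duplicate : (h : Elem n r) {E rest : List (Entry n r)} {e : Entry n r} →
      Pick E e rest → e ∈ rest → sat h E ≡ sat h rest
    sat-drop-duplicate h {rest = rest} {e} pick e∈rest = ≡.trans (sat-↭ h (Pick⇒↭ pick)) (absorb (sat h rest) ≡.refl)
      where
        absorb : ∀ b → sat h rest ≡ b → satisfiesEntry h e ∧ b ≡ b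
        absorb false _  = ∧-zeroʳ _
        absorb true  eq = cong (_∧ true) (Equivalence.to T-≡ (allB-∈ (satisfiesEntry h) (Equivalence.from T-≡ eq) e∈rest))

    satisfied : (h : Elem n r) (e : Entry n r) → T (satisfiesEntry h e) → ω h (src e) ≡ tgt e × τ h (tgt e) ≡ col e
    satisfied h (i , j , c) t with Equivalence.to (T-∧ {does (ω h i ≟ j)}) t
    ... | hi≡j , hj≡c = T-does {d = ω h i ≟ j} hi≡j , T-does {d = τ h j ≟ c} hj≡c

    satisfied-same-target : (h : Elem n r) → IsElem h → (e e′ : Entry n r) →
      T (satisfiesEntry h e) → T (satisfiesEntry h e′) → tgt e ≡ tgt e′ → e ≡ e′
    satisfied-same-target h h-inj (i , j , c) (i′ , .j , c′) t t′ ≡.refl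
      with satisfied h (i , j , c) t | satisfied h (i′ , j , c′) t′
    ... | hi≡j , hj≡c | hi′≡j , hj≡c′ =
      cong₂ _,_ (h-inj (≡.trans hi≡j (sym hi′≡j))) (cong (j ,_) (≡.trans (sym hj≡c) hj≡c′))

    _≟ₑ_ : (e e′ : Entry n r) → Dec (e ≡ e′)
    _≟ₑ_ = ≡-dec _≟_ (≡-dec _≟_ _≟_)

    _occursIn?_ : (v : Fin n) (E : List (Entry n r)) → Dec (v occursIn E)
    v occursIn? E = any? (λ e → (v ≟ src e) ⊎-dec (v ≟ tgt e)) E

    FreshTarget? : (a : Fin n) (E : List (Entry n r)) (b : Fin n) → Dec (FreshTarget a E b)
    FreshTarget? a E b = ¬? (b ≟ a) ×-dec ¬? (b occursIn? E)

    HasFreshTarget : Entry n r → List (Entry n r) → Set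
    HasFreshTarget e rest = FreshTarget (src e) rest (tgt e)

    -- Following the entries from a satisfying h, every target is again a source, so the sources
    -- carry a cycle of h of length at most length E.
    no-fresh-target⇒unsat : {s : ℕ} (E : List (Entry n r)) {e₀ : Entry n r} → e₀ ∈ E → length E ≤ s →
      (∀ {e rest} → Pick E e rest → e ∉ rest) → (∀ {e rest} → Pick E e rest → ¬ HasFreshTarget e rest) →
      (h : Elem n r) → IsElem h → NoShortCycles s h → ¬ T (sat h E)
    no-fresh-target⇒unsat E e₀∈E E≤s no-dup no-fresh h h-inj h-noShort satE =
      short-cycle (closed⇒cycle (ω h) (map src E) (∈-map⁺ src e₀∈E) closed)
      where
        sat-at : ∀ {e} → e ∈ E → T (satisfiesEntry h e)
        sat-at = allB-∈ (satisfiesEntry h) satE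

        target-is-source : ∀ {e} → e ∈ E → tgt e ∈ map src E
        target-is-source {e} e∈E with ∈⇒Pick e∈E
        ... | rest , pick with tgt e ≟ src e
        ...   | yes t≡s = subst (_∈ map src E) (sym t≡s) (∈-map⁺ src e∈E)
        ...   | no t≢s with tgt e occursIn? rest
        ...     | no t∉rest = contradiction (t≢s , t∉rest) (no-fresh pick)
        ...     | yes t∈rest with find t∈rest
        ...       | e′ , e′∈rest , inj₁ t≡s′ = subst (_∈ map src E) (sym t≡s′) (∈-map⁺ src (Pick-⊆ pick e′∈rest))
        ...       | e′ , e′∈rest , inj₂ t≡t′ = contradiction (subst (_∈ rest) (sym e≡e′) e′∈rest) (no-dup pick)
          where
            e≡e′ : e ≡ e′
            e≡e′ = satisfied-same-target h h-inj e e′ (sat-at e∈E) (sat-at (Pick-⊆ pick e′∈rest)) t≡t′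

        closed : ∀ {v} → v ∈ map src E → ω h v ∈ map src E
        closed v∈sources with ∈-map⁻ src v∈sources
        ... | e , e∈E , ≡.refl = subst (_∈ map src E) (sym (proj₁ (satisfied h e (sat-at e∈E)))) (target-is-source e∈E)

        short-cycle : (∃₂ λ x p → 1 ≤ p × p ≤ length (map src E) × iter (ω h) p x ≡ x) → ⊥
        short-cycle (x , p , 1≤p , p≤len , cycle) =
          h-noShort x p 1≤p (≤-trans p≤len (≤-trans (≤-reflexive (length-map src E)) E≤s)) cycle

    #vertices : List (Entry n r) → ℕ
    #vertices E = sumℕ (λ v → 𝟙 (does (v occursIn? E))) (allFin n)

    -- Lexicographic in (length E , #vertices E), as #vertices E ≤ n.
    μ : List (Entry n r) → ℕ
    μ E = length E * suc n + #vertices E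

    private
      𝟙-does-mono : {P Q : Set} (p? : Dec P) (q? : Dec Q) → (P → Q) → 𝟙 (does p?) ≤ 𝟙 (does q?)
      𝟙-does-mono (yes p) (yes _) P→Q = ≤-refl
      𝟙-does-mono (yes p) (no ¬q) P→Q = contradiction (P→Q p) ¬q
      𝟙-does-mono (no _)  _       P→Q = z≤n

      𝟙-does-< : {P Q : Set} (p? : Dec P) (q? : Dec Q) → ¬ P → Q → 𝟙 (does p?) < 𝟙 (does q?)
      𝟙-does-< (yes p) _       ¬p q = contradiction p ¬p
      𝟙-does-< (no _)  (yes _) ¬p q = s≤s z≤n
      𝟙-does-< (no _)  (no ¬q) ¬p q = contradiction q ¬q

    #vertices≤n : (E : List (Entry n r)) → #vertices E ≤ n
    #vertices≤n E = begin
      #vertices E                ≤⟨ sumℕ-mono-≤ (allFin n) (λ v → 𝟙-does-mono (v occursIn? E) (yes tt) _) ⟩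
      sumℕ (λ _ → 1) (allFin n)  ≡⟨ sumℕ-const 1 (allFin n) ⟩
      length (allFin n) * 1      ≡⟨ *-identityʳ _ ⟩
      length (allFin n)          ≡⟨ length-tabulate {n = n} id ⟩
      n                          ∎
      where open ≤-Reasoning

    μ-↭ : {E E′ : List (Entry n r)} → E ↭ E′ → μ E ≡ μ E′
    μ-↭ {E} {E′} E↭E′ = cong₂ _+_ (cong (_* suc n) (↭-length E↭E′))
      (sumℕ-cong (allFin n) (λ v _ → ≤-antisym
        (𝟙-does-mono (v occursIn? E) (v occursIn? E′) (Any-resp-↭ E↭E′))
        (𝟙-does-mono (v occursIn? E′) (v occursIn? E) (Any-resp-↭ (↭-sym E↭E′)))))

    μ-pick : {E rest : List (Entry n r)} {e : Entry n r} → Pick E e rest → μ rest < μ E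
    μ-pick {E} {rest} {e} pick = begin-strict
      length rest * suc n + #vertices rest   ≤⟨ +-monoʳ-≤ (length rest * suc n) (#vertices≤n rest) ⟩
      length rest * suc n + n                <⟨ +-monoʳ-< (length rest * suc n) (n<1+n n) ⟩
      length rest * suc n + suc n            ≡⟨ +-comm (length rest * suc n) (suc n) ⟩
      suc (length rest) * suc n              ≤⟨ m≤m+n _ _ ⟩
      μ (e ∷ rest)                           ≡⟨ μ-↭ (Pick⇒↭ pick) ⟨
      μ E                                    ∎
      where open ≤-Reasoning

    μ-sibling : {E rest : List (Entry n r)} {a b b₀ : Fin n} {c₀ : Fin r} → Pick E (a , b₀ , c₀) rest →
      FreshTarget a rest b₀ → ¬ FreshTarget a rest b → (c : Fin r) → μ ((a , b , c) ∷ rest) < μ E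
    μ-sibling {E} {rest} {a} {b} {b₀} {c₀} pick (b₀≢a , b₀∉rest) b-not-fresh c = begin-strict
      μ E′                                             ≡⟨⟩
      suc (length rest) * suc n + #vertices E′         <⟨ +-monoʳ-< (suc (length rest) * suc n) fewer-vertices ⟩
      suc (length rest) * suc n + #vertices E°         ≡⟨ μ-↭ (Pick⇒↭ pick) ⟨
      μ E                                              ∎
      where
        open ≤-Reasoning
        E′ E° : List (Entry n r)
        E′ = (a , b , c) ∷ rest
        E° = (a , b₀ , c₀) ∷ rest
        fewer : ∀ {v} → v occursIn E′ → v occursIn E°
        fewer (here (inj₁ v≡a))    = here (inj₁ v≡a)
        fewer (here (inj₂ ≡.refl)) with b ≟ a
        ... | yes b≡a = here (inj₁ b≡a)
        ... | no b≢a with b occursIn? rest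
        ...   | yes b∈rest = there b∈rest
        ...   | no b∉rest  = contradiction (b≢a , b∉rest) b-not-fresh
        fewer (there v∈rest)       = there v∈rest
        b₀-new : ¬ (b₀ occursIn E′)
        b₀-new (here (inj₁ b₀≡a))   = b₀≢a b₀≡a
        b₀-new (here (inj₂ ≡.refl)) = b-not-fresh (b₀≢a , b₀∉rest)
        b₀-new (there b₀∈rest)      = b₀∉rest b₀∈rest
        fewer-vertices : #vertices E′ < #vertices E°
        fewer-vertices = sumℕ-mono-< (allFin n) (λ v → 𝟙-does-mono (v occursIn? E′) (v occursIn? E°) fewer)
          (∈-allFin b₀) (𝟙-does-< (b₀ occursIn? E′) (b₀ occursIn? E°) b₀-new (here (inj₂ ≡.refl)))

  module SameDensity {n r : ℕ} .{{_ : NonZero r}} {s : ℕ} (1≤s : 1 ≤ s)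
    (g₁ : Elem n r) (g₁-noShort : NoShortCycles s g₁) (L₁ : List (Elem n r)) (L₁-enum : Enumerates L₁ (ConjClass g₁))
    (g₂ : Elem n r) (g₂-noShort : NoShortCycles s g₂) (L₂ : List (Elem n r)) (L₂-enum : Enumerates L₂ (ConjClass g₂))
    where

    private
      module C₁ = ClassCounts 1≤s g₁ g₁-noShort L₁ L₁-enum
      module C₂ = ClassCounts 1≤s g₂ g₂-noShort L₂ L₂-enum
      N₁ N₂ : ℕ
      N₁ = length L₁
      N₂ = length L₂

    SameDensity : List (Entry n r) → Set
    SameDensity E = #sat L₁ E * N₂ ≡ #sat L₂ E * N₁

    sameDensity-[] : SameDensity []
    sameDensity-[] = ≡.trans (cong (_* N₂) (#sat-[] L₁)) (≡.trans (*-comm N₁ N₂) (cong (_* N₁) (sym (#sat-[] L₂))))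

    sameDensity-resp : (E E′ : List (Entry n r)) → (∀ h → sat h E ≡ sat h E′) → SameDensity E′ → SameDensity E
    sameDensity-resp E E′ sat≡ same = ≡.trans (cong (_* N₂) (#sat≡ L₁)) (≡.trans same (cong (_* N₁) (sym (#sat≡ L₂))))
      where
        #sat≡ : ∀ L → #sat L E ≡ #sat L E′
        #sat≡ L = sumℕ-cong L (λ h _ → cong 𝟙 (sat≡ h))

    sameDensity-unsat : (E : List (Entry n r)) → (∀ h → IsElem h → NoShortCycles s h → ¬ T (sat h E)) → SameDensity E
    sameDensity-unsat E unsat = ≡.trans (cong (_* N₂) (C₁.#sat-unsat E unsat)) (sym (cong (_* N₁) (C₂.#sat-unsat E unsat)))

    -- All fresh choices (b , c) for the first entry contribute the same amount (#sat-fresh-colours)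
    -- and the other choices agree by hypothesis, so comparing totals (#sat-choices) settles that amount.
    sameDensity-fresh : (a b₀ : Fin n) (c₀ : Fin r) (rest : List (Entry n r)) → FreshTarget a rest b₀ →
      SameDensity rest → (∀ b c → ¬ FreshTarget a rest b → SameDensity ((a , b , c) ∷ rest)) →
      SameDensity ((a , b₀ , c₀) ∷ rest)
    sameDensity-fresh a b₀ c₀ rest b₀-fresh rest-same sibling-same = *-cancelˡ-≡ _ _ r (begin
      r * (#sat L₁ E° * N₂)   ≡⟨ *-assoc r _ N₂ ⟨
      r * #sat L₁ E° * N₂     ≡⟨ fresh-amounts-agree ⟩
      r * #sat L₂ E° * N₁     ≡⟨ *-assoc r _ N₁ ⟩
      r * (#sat L₂ E° * N₁)   ∎)
      where
        open ≡.≡-Reasoning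
        E° : List (Entry n r)
        E° = (a , b₀ , c₀) ∷ rest
        choices : List (Elem n r) → Fin n → ℕ
        choices L b = sumℕ (λ c → #sat L ((a , b , c) ∷ rest)) (allFin r)
        non-fresh : ∀ b → ¬ FreshTarget a rest b → choices L₁ b * N₂ ≡ choices L₂ b * N₁
        non-fresh b not-fresh = begin
          choices L₁ b * N₂                                   ≡⟨ sumℕ-*ʳ N₂ (#sat-sibling L₁) (allFin r) ⟨
          sumℕ (λ c → #sat-sibling L₁ c * N₂) (allFin r)      ≡⟨ sumℕ-cong (allFin r) (λ c _ → sibling-same b c not-fresh) ⟩
          sumℕ (λ c → #sat-sibling L₂ c * N₁) (allFin r)      ≡⟨ sumℕ-*ʳ N₁ (#sat-sibling L₂) (allFin r) ⟩
          choices L₂ b * N₁                                   ∎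
          where
            #sat-sibling : List (Elem n r) → Fin r → ℕ
            #sat-sibling L c = #sat L ((a , b , c) ∷ rest)
        same-totals : sumℕ (λ b → choices L₁ b * N₂) (allFin n) ≡ sumℕ (λ b → choices L₂ b * N₁) (allFin n)
        same-totals = begin
          sumℕ (λ b → choices L₁ b * N₂) (allFin n) ≡⟨ sumℕ-*ʳ N₂ (choices L₁) (allFin n) ⟩
          sumℕ (choices L₁) (allFin n) * N₂         ≡⟨ cong (_* N₂) (#sat-choices L₁ a rest) ⟨
          #sat L₁ rest * N₂                         ≡⟨ rest-same ⟩
          #sat L₂ rest * N₁                         ≡⟨ cong (_* N₁) (#sat-choices L₂ a rest) ⟩
          sumℕ (choices L₂) (allFin n) * N₁         ≡⟨ sumℕ-*ʳ N₁ (choices L₂) (allFin n) ⟨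
          sumℕ (λ b → choices L₂ b * N₁) (allFin n) ∎
        fresh-amounts-agree : r * #sat L₁ E° * N₂ ≡ r * #sat L₂ E° * N₁
        fresh-amounts-agree = equal-sums⇒equal-constants (FreshTarget? a rest) (allFin n)
          (λ b b-fresh → cong (_* N₂) (C₁.#sat-fresh-colours a b b₀ rest b-fresh b₀-fresh c₀))
          (λ b b-fresh → cong (_* N₁) (C₂.#sat-fresh-colours a b b₀ rest b-fresh b₀-fresh c₀))
          non-fresh same-totals (∈-allFin b₀) b₀-fresh

    private
      Pick-shorter : {E rest : List (Entry n r)} {e : Entry n r} → Pick E e rest → length E ≤ s → length rest ≤ s
      Pick-shorter {rest = rest} pick E≤s = ≤-trans (n≤1+n (length rest)) (≡.subst (_≤ s) (↭-length (Pick⇒↭ pick)) E≤s)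

    sameDensity-acc : (E : List (Entry n r)) → Acc _<_ (μ E) → length E ≤ s → SameDensity E
    sameDensity-acc []        _             _   = sameDensity-[]
    sameDensity-acc E@(_ ∷ _) (acc smaller) E≤s with pick? {A = Entry n r} _∈_ (λ e rest → any? (e ≟ₑ_) rest) E
    ... | inj₁ (e , rest , pick , e∈rest) =
      sameDensity-resp E rest (λ h → sat-drop-duplicate h pick e∈rest)
        (sameDensity-acc rest (smaller (μ-pick pick)) (Pick-shorter pick E≤s))
    ... | inj₂ no-dup with pick? {A = Entry n r} HasFreshTarget (λ e rest → FreshTarget? (src e) rest (tgt e)) E
    ...   | inj₂ no-fresh = sameDensity-unsat E (no-fresh-target⇒unsat E (here ≡.refl) E≤s no-dup no-fresh)
    ...   | inj₁ ((a , b₀ , c₀) , rest , pick , b₀-fresh) =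
      sameDensity-resp E ((a , b₀ , c₀) ∷ rest) (λ h → sat-↭ h (Pick⇒↭ pick))
        (sameDensity-fresh a b₀ c₀ rest b₀-fresh
          (sameDensity-acc rest (smaller (μ-pick pick)) (Pick-shorter pick E≤s))
          (λ b c b-not-fresh → sameDensity-acc ((a , b , c) ∷ rest) (smaller (μ-sibling pick b₀-fresh b-not-fresh c))
            (≡.subst (_≤ s) (↭-length (Pick⇒↭ pick)) E≤s)))

    sameDensity : (E : List (Entry n r)) → length E ≤ s → SameDensity E
    sameDensity E = sameDensity-acc E (<-wellFounded (μ E))

module IndicatorSums where

  open Sums
  open ColouredPermutations
  open Counting
  open Density
  open import Data.Bool using (Bool; true; false; _∧_)
  open import Data.Bool.Properties using (∧-assoc)
  import Data.Integer as ℤ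
  import Data.Integer.Properties as ℤ
  open import Data.List using (List; []; _∷_; map; length; _++_)
  open import Data.List.Membership.Propositional using (_∈_)
  open import Data.List.Properties using (length-++; length-map)
  open import Data.List.Relation.Unary.All as All using (All; []; _∷_)
  import Data.List.Relation.Unary.All.Properties as All
  open import Data.List.Relation.Unary.Any using (here; there)
  open import Data.Nat using (ℕ; zero; suc; _≤_; NonZero; z≤n)
  import Data.Nat as ℕ
  import Data.Nat.Properties as ℕ
  open import Data.Product using (_×_; _,_; proj₁; proj₂)
  open import Data.Rational using (ℚ; 0ℚ; 1ℚ; _+_; _*_; _/_; toℚᵘ)
  open import Data.Rational.Properties
  open import Data.Rational.Solver using (module +-*-Solver)
  open import Data.Rational.Unnormalised using (ℚᵘ; mkℚᵘ; *≡*) renaming (_≃_ to _≃ᵘ_)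
  import Data.Rational.Unnormalised.Properties as ℚᵘ
  open import Relation.Binary.PropositionalEquality
  open +-*-Solver using (solve; _:*_; _:+_; _:=_)

  ℕ→ℚ : ℕ → ℚ
  ℕ→ℚ k = ℤ.+ k / 1

  private
    ℕ→ℚᵘ : ℕ → ℚᵘ
    ℕ→ℚᵘ k = mkℚᵘ (ℤ.+ k) 0

    toℚᵘ-ℕ→ℚ : ∀ k → toℚᵘ (ℕ→ℚ k) ≃ᵘ ℕ→ℚᵘ k
    toℚᵘ-ℕ→ℚ k = toℚᵘ-fromℚᵘ (ℕ→ℚᵘ k)

  ℕ→ℚ-+ : ∀ a b → ℕ→ℚ (a ℕ.+ b) ≡ ℕ→ℚ a + ℕ→ℚ b
  ℕ→ℚ-+ a b = toℚᵘ-injective (ℚᵘ.≃-trans (toℚᵘ-ℕ→ℚ (a ℕ.+ b)) (ℚᵘ.≃-sym (ℚᵘ.≃-trans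
    (toℚᵘ-homo-+ (ℕ→ℚ a) (ℕ→ℚ b)) (ℚᵘ.≃-trans (ℚᵘ.+-cong (toℚᵘ-ℕ→ℚ a) (toℚᵘ-ℕ→ℚ b)) (*≡* (begin
      (ℤ.+ a ℤ.* ℤ.+ 1 ℤ.+ ℤ.+ b ℤ.* ℤ.+ 1) ℤ.* ℤ.+ 1 ≡⟨ ℤ.*-identityʳ _ ⟩
      ℤ.+ a ℤ.* ℤ.+ 1 ℤ.+ ℤ.+ b ℤ.* ℤ.+ 1             ≡⟨ cong₂ ℤ._+_ (ℤ.*-identityʳ (ℤ.+ a)) (ℤ.*-identityʳ (ℤ.+ b)) ⟩
      ℤ.+ a ℤ.+ ℤ.+ b                                 ≡⟨ ℤ.pos-+ a b ⟨
      ℤ.+ (a ℕ.+ b)                                   ≡⟨ ℤ.*-identityʳ _ ⟨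
      ℤ.+ (a ℕ.+ b) ℤ.* ℤ.+ 1                         ∎))))))
    where open ≡-Reasoning

  ℕ→ℚ-* : ∀ a b → ℕ→ℚ (a ℕ.* b) ≡ ℕ→ℚ a * ℕ→ℚ b
  ℕ→ℚ-* a b = toℚᵘ-injective (ℚᵘ.≃-trans (toℚᵘ-ℕ→ℚ (a ℕ.* b)) (ℚᵘ.≃-sym (ℚᵘ.≃-trans
    (toℚᵘ-homo-* (ℕ→ℚ a) (ℕ→ℚ b)) (ℚᵘ.≃-trans (ℚᵘ.*-cong (toℚᵘ-ℕ→ℚ a) (toℚᵘ-ℕ→ℚ b))
      (*≡* (trans (ℤ.*-identityʳ _) (trans (sym (ℤ.pos-* a b)) (sym (ℤ.*-identityʳ _)))))))))

  ℕ→ℚ-*-inverse : ∀ m → ℕ→ℚ (suc m) * (ℤ.+ 1 / suc m) ≡ 1ℚ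
  ℕ→ℚ-*-inverse m = toℚᵘ-injective (ℚᵘ.≃-trans (toℚᵘ-homo-* (ℕ→ℚ (suc m)) (ℤ.+ 1 / suc m))
    (ℚᵘ.≃-trans (ℚᵘ.*-cong (toℚᵘ-ℕ→ℚ (suc m)) (toℚᵘ-fromℚᵘ (mkℚᵘ (ℤ.+ 1) m)))
      (ℚᵘ.≃-trans (*≡* (trans (ℤ.*-identityʳ _) (trans (ℤ.*-identityʳ (ℤ.+ suc m))
        (trans (cong (λ k → ℤ.+ suc k) (sym (ℕ.+-identityʳ m))) (sym (ℤ.*-identityˡ _))))))
        (ℚᵘ.≃-sym (toℚᵘ-ℕ→ℚ 1)))))

  mean-map-cross : {A : Set} (f : A → ℚ) {x₁ x₂ : A} (L₁ L₂ : List A) → x₁ ∈ L₁ → x₂ ∈ L₂ →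
    sumℚ (map f L₁) * ℕ→ℚ (length L₂) ≡ sumℚ (map f L₂) * ℕ→ℚ (length L₁) →
    mean (map f L₁) ≡ mean (map f L₂)
  mean-map-cross f (x ∷ xs) (y ∷ ys) _ _ cross rewrite length-map f xs | length-map f ys = begin
    S₁ * i₁                                     ≡⟨ *-identityʳ _ ⟨
    (S₁ * i₁) * 1ℚ                              ≡⟨ cong ((S₁ * i₁) *_) (ℕ→ℚ-*-inverse (length ys)) ⟨
    (S₁ * i₁) * (ℕ→ℚ (suc (length ys)) * i₂)    ≡⟨ rearrange S₁ i₁ _ i₂ ⟩
    (S₁ * ℕ→ℚ (suc (length ys))) * (i₁ * i₂)    ≡⟨ cong (_* (i₁ * i₂)) cross ⟩
    (S₂ * ℕ→ℚ (suc (length xs))) * (i₁ * i₂)    ≡⟨ rearrange′ S₂ _ i₁ i₂ ⟩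
    (S₂ * i₂) * (ℕ→ℚ (suc (length xs)) * i₁)    ≡⟨ cong ((S₂ * i₂) *_) (ℕ→ℚ-*-inverse (length xs)) ⟩
    (S₂ * i₂) * 1ℚ                              ≡⟨ *-identityʳ _ ⟩
    S₂ * i₂                                     ∎
    where
      open ≡-Reasoning
      S₁ S₂ i₁ i₂ : ℚ
      S₁ = sumℚ (map f (x ∷ xs))
      S₂ = sumℚ (map f (y ∷ ys))
      i₁ = ℤ.+ 1 / suc (length xs)
      i₂ = ℤ.+ 1 / suc (length ys)
      rearrange : ∀ a b c d → (a * b) * (c * d) ≡ (a * c) * (b * d)
      rearrange = solve 4 (λ a b c d → (a :* b) :* (c :* d) := (a :* c) :* (b :* d)) refl
      rearrange′ : ∀ a b c d → (a * b) * (c * d) ≡ (a * d) * (b * c)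
      rearrange′ = solve 4 (λ a b c d → (a :* b) :* (c :* d) := (a :* d) :* (b :* c)) refl

  sumℚ-map-cong : {A : Set} {f g : A → ℚ} (xs : List A) → (∀ x → x ∈ xs → f x ≡ g x) →
    sumℚ (map f xs) ≡ sumℚ (map g xs)
  sumℚ-map-cong []       f≗g = refl
  sumℚ-map-cong (x ∷ xs) f≗g = cong₂ _+_ (f≗g x (here refl)) (sumℚ-map-cong xs (λ y y∈xs → f≗g y (there y∈xs)))

  𝟙ℚ : Bool → ℚ
  𝟙ℚ true  = 1ℚ
  𝟙ℚ false = 0ℚ

  𝟙ℚ-∧ : ∀ x y → 𝟙ℚ (x ∧ y) ≡ 𝟙ℚ x * 𝟙ℚ y
  𝟙ℚ-∧ true  y = sym (*-identityˡ (𝟙ℚ y))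
  𝟙ℚ-∧ false y = sym (*-zeroˡ (𝟙ℚ y))

  ℕ→ℚ-𝟙 : ∀ b → ℕ→ℚ (𝟙 b) ≡ 𝟙ℚ b
  ℕ→ℚ-𝟙 true  = refl
  ℕ→ℚ-𝟙 false = refl

  allB-++ : {A : Set} (p : A → Bool) (E F : List A) → allB p (E ++ F) ≡ allB p E ∧ allB p F
  allB-++ p []      F = refl
  allB-++ p (x ∷ E) F = trans (cong (p x ∧_) (allB-++ p E F)) (sym (∧-assoc (p x) (allB p E) (allB p F)))

  IndicatorSum : ℕ → ℕ → Set
  IndicatorSum n r = List (ℚ × List (Entry n r))

  module _ {n r : ℕ} .{{_ : NonZero r}} where

    ⟦_⟧ : IndicatorSum n r → Elem n r → ℚ
    ⟦ [] ⟧          h = 0ℚ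
    ⟦ (q , E) ∷ P ⟧ h = q * 𝟙ℚ (sat h E) + ⟦ P ⟧ h

    infixl 7 _⊗_
    _⊗_ : IndicatorSum n r → IndicatorSum n r → IndicatorSum n r
    []            ⊗ Q = []
    ((a , E) ∷ P) ⊗ Q = map (λ (b , F) → a * b , E ++ F) Q ++ P ⊗ Q

    _⊗^_ : IndicatorSum n r → ℕ → IndicatorSum n r
    P ⊗^ zero  = (1ℚ , []) ∷ []
    P ⊗^ suc k = P ⊗ (P ⊗^ k)

    ⟦⟧-++ : (P Q : IndicatorSum n r) (h : Elem n r) → ⟦ P ++ Q ⟧ h ≡ ⟦ P ⟧ h + ⟦ Q ⟧ h
    ⟦⟧-++ []            Q h = sym (+-identityˡ (⟦ Q ⟧ h))
    ⟦⟧-++ ((q , E) ∷ P) Q h =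
      trans (cong ((q * 𝟙ℚ (sat h E)) +_) (⟦⟧-++ P Q h)) (sym (+-assoc (q * 𝟙ℚ (sat h E)) (⟦ P ⟧ h) (⟦ Q ⟧ h)))

    ⟦⟧-⊗ : (P Q : IndicatorSum n r) (h : Elem n r) → ⟦ P ⊗ Q ⟧ h ≡ ⟦ P ⟧ h * ⟦ Q ⟧ h
    ⟦⟧-⊗ []            Q h = sym (*-zeroˡ (⟦ Q ⟧ h))
    ⟦⟧-⊗ ((a , E) ∷ P) Q h = begin
      ⟦ aE⊗ Q ++ P ⊗ Q ⟧ h               ≡⟨ ⟦⟧-++ (aE⊗ Q) (P ⊗ Q) h ⟩
      ⟦ aE⊗ Q ⟧ h + ⟦ P ⊗ Q ⟧ h          ≡⟨ cong₂ _+_ (⟦aE⊗⟧ Q) (⟦⟧-⊗ P Q h) ⟩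
      aE * ⟦ Q ⟧ h + ⟦ P ⟧ h * ⟦ Q ⟧ h   ≡⟨ *-distribʳ-+ (⟦ Q ⟧ h) aE (⟦ P ⟧ h) ⟨
      (aE + ⟦ P ⟧ h) * ⟦ Q ⟧ h           ∎
      where
        open ≡-Reasoning
        aE : ℚ
        aE = a * 𝟙ℚ (sat h E)
        aE⊗ : IndicatorSum n r → IndicatorSum n r
        aE⊗ = map (λ (b , F) → a * b , E ++ F)
        interchange : ∀ a b x y → (a * b) * (x * y) ≡ (a * x) * (b * y)
        interchange = solve 4 (λ a b x y → (a :* b) :* (x :* y) := (a :* x) :* (b :* y)) refl
        ⟦aE⊗⟧ : ∀ Q → ⟦ aE⊗ Q ⟧ h ≡ aE * ⟦ Q ⟧ h
        ⟦aE⊗⟧ []            = sym (*-zeroʳ aE)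
        ⟦aE⊗⟧ ((b , F) ∷ Q) = begin
          (a * b) * 𝟙ℚ (sat h (E ++ F)) + ⟦ aE⊗ Q ⟧ h        ≡⟨ cong (λ x → (a * b) * x + ⟦ aE⊗ Q ⟧ h)
                                                                  (trans (cong 𝟙ℚ (allB-++ (satisfiesEntry h) E F))
                                                                    (𝟙ℚ-∧ (sat h E) (sat h F))) ⟩
          (a * b) * (𝟙ℚ (sat h E) * 𝟙ℚ (sat h F)) + ⟦ aE⊗ Q ⟧ h ≡⟨ cong₂ _+_ (interchange a b _ _) (⟦aE⊗⟧ Q) ⟩
          aE * (b * 𝟙ℚ (sat h F)) + aE * ⟦ Q ⟧ h              ≡⟨ *-distribˡ-+ aE _ (⟦ Q ⟧ h) ⟨
          aE * (b * 𝟙ℚ (sat h F) + ⟦ Q ⟧ h)                   ∎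

    ⟦⟧-⊗^ : (P : IndicatorSum n r) (k : ℕ) (h : Elem n r) → ⟦ P ⊗^ k ⟧ h ≡ powℚ (⟦ P ⟧ h) k
    ⟦⟧-⊗^ P zero    h = trans (+-identityʳ _) (*-identityʳ 1ℚ)
    ⟦⟧-⊗^ P (suc k) h = trans (⟦⟧-⊗ P (P ⊗^ k) h) (cong (⟦ P ⟧ h *_) (⟦⟧-⊗^ P k h))

    Degree≤ : ℕ → IndicatorSum n r → Set
    Degree≤ m P = All (λ (_ , E) → length E ≤ m) P

    degree-⊗ : {m m′ : ℕ} (P Q : IndicatorSum n r) → Degree≤ m P → Degree≤ m′ Q → Degree≤ (m ℕ.+ m′) (P ⊗ Q)
    degree-⊗ []            Q []        Q≤ = []
    degree-⊗ ((a , E) ∷ P) Q (E≤ ∷ P≤) Q≤ = All.++⁺ (All.map⁺ (concatenated Q Q≤)) (degree-⊗ P Q P≤ Q≤)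
      where
        concatenated : ∀ Q → Degree≤ _ Q → All (λ (_ , F) → length (E ++ F) ≤ _) Q
        concatenated []      []        = []
        concatenated (_ ∷ Q) (F≤ ∷ Q≤) =
          ℕ.≤-trans (ℕ.≤-reflexive (length-++ E)) (ℕ.+-mono-≤ E≤ F≤) ∷ concatenated Q Q≤

    degree-⊗^ : {m : ℕ} (P : IndicatorSum n r) (k : ℕ) → Degree≤ m P → Degree≤ (m ℕ.* k) (P ⊗^ k)
    degree-⊗^ {m} P zero    P≤ = z≤n ∷ []
    degree-⊗^ {m} P (suc k) P≤ =
      subst (λ d → Degree≤ d (P ⊗^ suc k)) (sym (ℕ.*-suc m k)) (degree-⊗ P (P ⊗^ k) P≤ (degree-⊗^ P k P≤))

    weightedCount : IndicatorSum n r → List (Elem n r) → ℚ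
    weightedCount []            L = 0ℚ
    weightedCount ((q , E) ∷ P) L = q * ℕ→ℚ (#sat L E) + weightedCount P L

    weightedCount-[] : (P : IndicatorSum n r) → weightedCount P [] ≡ 0ℚ
    weightedCount-[] []            = refl
    weightedCount-[] ((q , E) ∷ P) = trans (cong₂ _+_ (*-zeroʳ q) (weightedCount-[] P)) (+-identityʳ 0ℚ)

    weightedCount-∷ : (P : IndicatorSum n r) (h : Elem n r) (L : List (Elem n r)) →
      weightedCount P (h ∷ L) ≡ ⟦ P ⟧ h + weightedCount P L
    weightedCount-∷ []            h L = sym (+-identityʳ 0ℚ)
    weightedCount-∷ ((q , E) ∷ P) h L = begin
      q * ℕ→ℚ (𝟙 (sat h E) ℕ.+ #sat L E) + weightedCount P (h ∷ L)
        ≡⟨ cong₂ (λ x y → q * x + y) count-∷ (weightedCount-∷ P h L) ⟩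
      q * (𝟙ℚ (sat h E) + ℕ→ℚ (#sat L E)) + (⟦ P ⟧ h + weightedCount P L)
        ≡⟨ regroup q _ _ (⟦ P ⟧ h) _ ⟩
      (q * 𝟙ℚ (sat h E) + ⟦ P ⟧ h) + (q * ℕ→ℚ (#sat L E) + weightedCount P L) ∎
      where
        open ≡-Reasoning
        count-∷ : ℕ→ℚ (𝟙 (sat h E) ℕ.+ #sat L E) ≡ 𝟙ℚ (sat h E) + ℕ→ℚ (#sat L E)
        count-∷ = trans (ℕ→ℚ-+ (𝟙 (sat h E)) (#sat L E)) (cong (_+ ℕ→ℚ (#sat L E)) (ℕ→ℚ-𝟙 (sat h E)))
        regroup : ∀ q a c p w → q * (a + c) + (p + w) ≡ (q * a + p) + (q * c + w)
        regroup = solve 5 (λ q a c p w → q :* (a :+ c) :+ (p :+ w) := (q :* a :+ p) :+ (q :* c :+ w)) refl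

    sumℚ-⟦⟧ : (P : IndicatorSum n r) (L : List (Elem n r)) → sumℚ (map ⟦ P ⟧ L) ≡ weightedCount P L
    sumℚ-⟦⟧ P []      = sym (weightedCount-[] P)
    sumℚ-⟦⟧ P (h ∷ L) = trans (cong (⟦ P ⟧ h +_) (sumℚ-⟦⟧ P L)) (sym (weightedCount-∷ P h L))

    weightedCount-cross : (P : IndicatorSum n r) (L₁ L₂ : List (Elem n r)) →
      All (λ (_ , E) → #sat L₁ E ℕ.* length L₂ ≡ #sat L₂ E ℕ.* length L₁) P →
      weightedCount P L₁ * ℕ→ℚ (length L₂) ≡ weightedCount P L₂ * ℕ→ℚ (length L₁)
    weightedCount-cross []            L₁ L₂ []             = trans (*-zeroˡ N₂) (sym (*-zeroˡ N₁))
      where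
        N₁ N₂ : ℚ
        N₁ = ℕ→ℚ (length L₁)
        N₂ = ℕ→ℚ (length L₂)
    weightedCount-cross ((q , E) ∷ P) L₁ L₂ (cross ∷ rest) = begin
      (q * ℕ→ℚ (#sat L₁ E) + weightedCount P L₁) * N₂      ≡⟨ distrib q _ (weightedCount P L₁) N₂ ⟩
      q * (ℕ→ℚ (#sat L₁ E) * N₂) + weightedCount P L₁ * N₂ ≡⟨ cong₂ (λ x y → q * x + y) count-cross
                                                                (weightedCount-cross P L₁ L₂ rest) ⟩
      q * (ℕ→ℚ (#sat L₂ E) * N₁) + weightedCount P L₂ * N₁ ≡⟨ distrib q _ (weightedCount P L₂) N₁ ⟨
      (q * ℕ→ℚ (#sat L₂ E) + weightedCount P L₂) * N₁      ∎
      where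
        open ≡-Reasoning
        N₁ N₂ : ℚ
        N₁ = ℕ→ℚ (length L₁)
        N₂ = ℕ→ℚ (length L₂)
        distrib : ∀ q a w N → (q * a + w) * N ≡ q * (a * N) + w * N
        distrib = solve 4 (λ q a w N → (q :* a :+ w) :* N := q :* (a :* N) :+ w :* N) refl
        count-cross : ℕ→ℚ (#sat L₁ E) * N₂ ≡ ℕ→ℚ (#sat L₂ E) * N₁
        count-cross = trans (sym (ℕ→ℚ-* (#sat L₁ E) (length L₂)))
          (trans (cong ℕ→ℚ cross) (ℕ→ℚ-* (#sat L₂ E) (length L₁)))

    indicatorSum-means-agree : {s : ℕ} → 1 ℕ.≤ s → (P : IndicatorSum n r) → Degree≤ s P → {f : Elem n r → ℚ} →
      (∀ h → IsElem h → f h ≡ ⟦ P ⟧ h) →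
      (g₁ : Elem n r) → IsElem g₁ → NoShortCycles s g₁ → (L₁ : List (Elem n r)) → Enumerates L₁ (ConjClass g₁) →
      (g₂ : Elem n r) → IsElem g₂ → NoShortCycles s g₂ → (L₂ : List (Elem n r)) → Enumerates L₂ (ConjClass g₂) →
      mean (map f L₁) ≡ mean (map f L₂)
    indicatorSum-means-agree 1≤s P P≤s {f} f≡P g₁ g₁-elem g₁-noShort L₁ L₁-enum g₂ g₂-elem g₂-noShort L₂ L₂-enum =
      mean-map-cross f L₁ L₂ (C₁.ConjClass⇒member {g₁} (ConjClass-refl g₁ g₁-elem))
        (C₂.ConjClass⇒member {g₂} (ConjClass-refl g₂ g₂-elem)) (begin
          sumℚ (map f L₁) * N₂      ≡⟨ cong (_* N₂) (class-sum g₁ L₁ C₁.member⇒ConjClass) ⟩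
          weightedCount P L₁ * N₂   ≡⟨ weightedCount-cross P L₁ L₂ (All.map (λ {(_ , E)} → sameDensity E) P≤s) ⟩
          weightedCount P L₂ * N₁   ≡⟨ cong (_* N₁) (class-sum g₂ L₂ C₂.member⇒ConjClass) ⟨
          sumℚ (map f L₂) * N₁      ∎)
      where
        open ≡-Reasoning
        N₁ N₂ : ℚ
        N₁ = ℕ→ℚ (length L₁)
        N₂ = ℕ→ℚ (length L₂)
        module C₁ = ClassCounts 1≤s g₁ g₁-noShort L₁ L₁-enum
        module C₂ = ClassCounts 1≤s g₂ g₂-noShort L₂ L₂-enum
        open SameDensity 1≤s g₁ g₁-noShort L₁ L₁-enum g₂ g₂-noShort L₂ L₂-enum
        class-sum : ∀ g L → (∀ {h} → h ∈ L → ConjClass g h) → sumℚ (map f L) ≡ weightedCount P L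
        class-sum g L member⇒C = trans (sumℚ-map-cong L (λ h h∈L → f≡P h (proj₁ (member⇒C {h} h∈L)))) (sumℚ-⟦⟧ P L)

  indicator-allB : {n r : ℕ} (K : PCP n r) (h : Elem n r) →
    indicator K h ≡ 𝟙ℚ (allB (satisfiesEntry h) (PCP.entries K))
  indicator-allB K h with allB (satisfiesEntry h) (PCP.entries K)
  ... | true  = refl
  ... | false = refl

  module _ {n r : ℕ} .{{_ : NonZero r}} where

    fromCombination : List (ℚ × PCP n r) → IndicatorSum n r
    fromCombination = map (λ (a , K) → a , PCP.entries K)

    ⟦fromCombination⟧ : (comb : List (ℚ × PCP n r)) (h : Elem n r) →
      sumℚ (map (λ aK → proj₁ aK * indicator (proj₂ aK) h) comb) ≡ ⟦ fromCombination comb ⟧ h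
    ⟦fromCombination⟧ []               h = refl
    ⟦fromCombination⟧ ((a , K) ∷ comb) h = cong₂ _+_ (cong (a *_) (indicator-allB K h)) (⟦fromCombination⟧ comb h)

    fromCombination-degree : {m : ℕ} (comb : List (ℚ × PCP n r)) → All (λ aK → size (proj₂ aK) ℕ.≤ m) comb →
      Degree≤ m (fromCombination comb)
    fromCombination-degree comb = All.map⁺

open ColouredPermutations
open IndicatorSums
open import Data.List using (List; map)
open import Data.Nat using (ℕ; _≤_; _*_; NonZero)
open import Data.Nat.Properties using (*-mono-≤)
open import Data.Product using (_,_)
open import Data.Rational using (ℚ)
open import Relation.Binary.PropositionalEquality

theorem1p1 : (n r m : ℕ) .{{_ : NonZero r}} → 1 ≤ n → 1 ≤ m →
    (X : Elem n r → ℚ) → DegreeAtMost m X →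
    (k : ℕ) → 1 ≤ k →
    (g₁ g₂ : Elem n r) → IsElem g₁ → IsElem g₂ →
    NoShortCycles (m * k) g₁ → NoShortCycles (m * k) g₂ →
    (L₁ L₂ : List (Elem n r)) →
    Enumerates L₁ (ConjClass g₁) → Enumerates L₂ (ConjClass g₂) →
    mean (map (λ g → powℚ (X g) k) L₁) ≡ mean (map (λ g → powℚ (X g) k) L₂)
theorem1p1 n r m _ 1≤m X (comb , comb≤m , X≡comb) k 1≤k
  g₁ g₂ g₁-elem g₂-elem g₁-noShort g₂-noShort L₁ L₂ L₁-enum L₂-enum =
  indicatorSum-means-agree (*-mono-≤ 1≤m 1≤k) P (degree-⊗^ P₁ k (fromCombination-degree comb comb≤m)) Xᵏ≡P
    g₁ g₁-elem g₁-noShort L₁ L₁-enum g₂ g₂-elem g₂-noShort L₂ L₂-enum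
  where
    P₁ P : IndicatorSum n r
    P₁ = fromCombination comb
    P = P₁ ⊗^ k
    Xᵏ≡P : ∀ h → IsElem h → powℚ (X h) k ≡ ⟦ P ⟧ h
    Xᵏ≡P h h-elem = begin
      powℚ (X h) k        ≡⟨ cong (λ x → powℚ x k) (trans (X≡comb h h-elem) (⟦fromCombination⟧ comb h)) ⟩
      powℚ (⟦ P₁ ⟧ h) k   ≡⟨ ⟦⟧-⊗^ P₁ k h ⟨
      ⟦ P ⟧ h             ∎
      where open ≡-Reasoning
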